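{- Let $N\ge0$, $K\ge1$, and $\mathcal A=\{V,U_N,U_{N-1},\ldots,U_0,D_1,\ldots,D_K\}$. For $m\ge0$ and $n\ge1$, $$|\mathcal F_{\mathcal A}(m,n)|=\sum_{k=0}^{\lfloor\frac{Nn+m}{N+K+1}\rfloor}(-1)^k\binom nk\binom{n(N+2)-k(N+K+1)+m}{2n},$$ $$|\mathcal P_{\mathcal A}(1,n)|=\frac1n\sum_{k=0}^{\lfloor\frac{Nn+1}{N+K+1}\rfloor}(-1)^k\binom nk\binom{n(N+2)-k(N+K+1)}{2n-1}.$$
   Context: Steps: $V=(0,-1)$ and $S_k=(1,k)$; $U_k=S_k$ for $k\ge0$, $D_j=S_{ -j}$ for $j\ge1$. For a set of steps $\mathcal S$, an $\mathcal S$-path is a finite sequence of steps from $\mathcal S$ starting at $(0,0)$. $\mathcal F_{\mathcal S}(m,n)$ is the set of $\mathcal S$-paths ending at $(n,-m)$; $\mathcal P_{\mathcal S}(m,n)$ is the subset of those all of whose points except possibly the last lie on or above the $x$-axis. -}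

module Defs where

open import Data.Nat as ℕ using (ℕ; zero; suc)
open import Data.Nat.Combinatorics using (_C_)
open import Data.Integer as ℤ using (ℤ; +_; -_; -[1+_])
open import Data.Fin using (Fin; toℕ)
open import Data.List using (List; []; _∷_)
open import Data.Product using (_×_; _,_; Σ)
open import Data.Unit using (⊤)
open import Relation.Binary.PropositionalEquality using (_≡_)

-- The step set A = {V, U_N, ..., U_0, D_1, ..., D_K}.
-- U i  stands for U_{toℕ i}  (i : Fin (N+1), so k = 0..N),
-- D j  stands for D_{1 + toℕ j}  (j : Fin K, so j = 1..K).
data Step (N K : ℕ) : Set where
  V : Step N K
  U : Fin (suc N) → Step N K
  D : Fin K → Step N K

Point : Set
Point = ℤ × ℤ

vec : ∀ {N K} → Step N K → Point
vec V     = (+ 0 , - (+ 1))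
vec (U i) = (+ 1 , + toℕ i)
vec (D j) = (+ 1 , - (+ suc (toℕ j)))

_⊕_ : Point → Point → Point
(a , b) ⊕ (c , d) = (a ℤ.+ c , b ℤ.+ d)

origin : Point
origin = (+ 0 , + 0)

endFrom : ∀ {N K} → Point → List (Step N K) → Point
endFrom p []       = p
endFrom p (s ∷ ss) = endFrom (p ⊕ vec s) ss

AboveExceptLast : ∀ {N K} → Point → List (Step N K) → Set
AboveExceptLast p        []       = ⊤
AboveExceptLast (x , y)  (s ∷ ss) = (+ 0 ℤ.≤ y) × AboveExceptLast ((x , y) ⊕ vec s) ss

F : (N K m n : ℕ) → Set
F N K m n = Σ (List (Step N K)) λ p → endFrom origin p ≡ (+ n , - (+ m))

P : (N K m n : ℕ) → Set
P N K m n = Σ (List (Step N K)) λ p →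
  (endFrom origin p ≡ (+ n , - (+ m))) × AboveExceptLast origin p

sumTo : ℕ → (ℕ → ℤ) → ℤ
sumTo zero    f = f 0
sumTo (suc u) f = sumTo u f ℤ.+ f (suc u)

sgn : ℕ → ℤ
sgn zero    = + 1
sgn (suc k) = - sgn k

module Submission where

-- Give V cost 1, U_k cost N − k and D_j cost N + j, so that a path with n non-vertical steps and
-- total cost c ends at (n, Nn − c): F_A(m, n) consists of the step sequences of width n and cost
-- Nn + m. The non-vertical steps have the costs 0, 1, …, N + K once each, so the step sequences of
-- width n are counted by (1 − x^(N+K+1))^n / (1 − x)^(2n+1), and expanding (1 − x^(N+K+1))^n gives
-- the alternating sum.
--
-- A path in P_A(1, n) starts with a non-vertical step, so it is a sequence of n blocks, each a
-- non-vertical step followed by a run of V's. By the cycle lemma exactly one of the n rotations of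
-- a block sequence of total height −1 stays above the axis at the block boundaries, which is all
-- that matters since a path only descends inside a block; and these block sequences are the step
-- sequences starting with a non-vertical step, counted by (1 − x^(N+K+1))^n / (1 − x)^(2n).

open import Data.Empty using (⊥-elim)
open import Data.Fin using (Fin; zero; suc; toℕ; fromℕ<; opposite; join; _↑ˡ_; _↑ʳ_)
import Data.Fin.Properties as Finₚ
open import Data.Fin.Permutation using (↔⇒≡)
open import Data.Integer as ℤ using (ℤ; +_; -_) renaming (_*_ to _*ℤ_)
import Data.Integer.Properties as ℤₚ
open import Data.Integer.Tactic.RingSolver using (solve-∀)
open import Data.List using (List; []; _∷_; _++_; take; drop; length; map; foldr; replicate)
import Data.List.Properties as Listₚ
open import Data.Nat as ℕ using (ℕ; zero; suc; _+_; _*_; _∸_; _≤_; _<_; _/_; z≤n; s≤s)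
open import Data.Nat.Combinatorics using (_C_; nCn≡1; nCk+nC[k+1]≡[n+1]C[k+1]; k>n⇒nCk≡0)
open import Data.Nat.DivMod using (m*n/n≡m; /-monoˡ-≤)
open import Data.Nat.GeneralisedArithmetic using (fold)
open import Data.Nat.ListAction using () renaming (sum to sumList)
import Data.Nat.Properties as ℕₚ
open import Data.Nat.Solver using (module +-*-Solver)
open import Data.Product using (Σ; ∃; _×_; _,_; proj₁; proj₂)
open import Data.Product.Function.Dependent.Propositional using (Σ-↔)
open import Data.Product.Function.NonDependent.Propositional using (_×-↔_)
open import Data.Sum using (_⊎_; inj₁; inj₂)
open import Data.Sum.Function.Propositional using (_⊎-↔_)
open import Data.Unit using (⊤; tt)
open import Function.Base using (_∘_; _∘′_)
open import Function.Bundles using (_↔_; mk↔ₛ′; Inverse; _⇔_; mk⇔; Equivalence)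
open import Function.Construct.Composition using (_⇔-∘_)
open import Function.Construct.Symmetry using (⇔-sym)
open import Function.Properties.Inverse using (↔-refl; ↔-sym; ↔-trans)
open import Function.Related.Propositional using (module EquationalReasoning)
open import Function.Related.TypeIsomorphisms using (Σ-assoc; Σ-distribʳ-⊎)
open import Relation.Binary.Definitions using (tri<; tri≈; tri>)
open import Relation.Binary.PropositionalEquality
open import Relation.Binary.PropositionalEquality.WithK using (≡-irrelevant)
open import Relation.Nullary using (¬_; Dec; yes; no)
open import Relation.Nullary.Irrelevant using (Irrelevant)
open +-*-Solver using (solve; _:=_; _:+_; _:*_; con)
open import Algebra.Definitions.RawMonoid ℕ.+-0-rawMonoid using (sum)
open import Algebra.Properties.Monoid.Sum ℤₚ.+-0-monoid using () renaming (sum to sumℤ; sum-cong-≗ to sumℤ-cong)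
open import Defs

private variable
  A B : Set

⊎-dropˡ : ¬ A → (A ⊎ B) ↔ B
⊎-dropˡ ¬a = mk↔ₛ′ (λ { (inj₁ a) → ⊥-elim (¬a a) ; (inj₂ b) → b }) inj₂ (λ _ → refl)
  (λ { (inj₁ a) → ⊥-elim (¬a a) ; (inj₂ b) → refl })

⊎-dropʳ : ¬ B → (A ⊎ B) ↔ A
⊎-dropʳ ¬b = mk↔ₛ′ (λ { (inj₁ a) → a ; (inj₂ b) → ⊥-elim (¬b b) }) inj₁ (λ _ → refl)
  (λ { (inj₁ a) → refl ; (inj₂ b) → ⊥-elim (¬b b) })

×-irrelevant : Irrelevant A → Irrelevant B → Irrelevant (A × B)
×-irrelevant irrA irrB (a , b) (a′ , b′) = cong₂ _,_ (irrA a a′) (irrB b b′)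

≡×≡-irrelevant : ∀ {a b : A} {c d : B} → Irrelevant (a ≡ b × c ≡ d)
≡×≡-irrelevant = ×-irrelevant ≡-irrelevant ≡-irrelevant

irrelevant-↔ : Irrelevant A → Irrelevant B → (A → B) → (B → A) → A ↔ B
irrelevant-↔ irrA irrB f g = mk↔ₛ′ f g (λ b → irrB _ b) (λ a → irrA _ a)

≡⇒↔ : ∀ (P : ℕ → Set) {m n} → m ≡ n → P m ↔ P n
≡⇒↔ P refl = ↔-refl

Σ-List : ∀ {P : List A → Set} →
         Σ (List A) P ↔ (P [] ⊎ Σ A λ a → Σ (List A) (P ∘ (a ∷_)))
Σ-List = mk↔ₛ′
  (λ { ([] , p) → inj₁ p ; (a ∷ as , p) → inj₂ (a , as , p) })
  (λ { (inj₁ p) → [] , p ; (inj₂ (a , as , p)) → a ∷ as , p })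
  (λ { (inj₁ p) → refl ; (inj₂ (a , as , p)) → refl })
  (λ { ([] , p) → refl ; (a ∷ as , p) → refl })

Σ-Fin-suc : ∀ {n} {P : Fin (suc n) → Set} → Σ (Fin (suc n)) P ↔ (P zero ⊎ Σ (Fin n) (P ∘ suc))
Σ-Fin-suc = mk↔ₛ′
  (λ { (zero , p) → inj₁ p ; (suc i , p) → inj₂ (i , p) })
  (λ { (inj₁ p) → zero , p ; (inj₂ (i , p)) → suc i , p })
  (λ { (inj₁ p) → refl ; (inj₂ (i , p)) → refl })
  (λ { (zero , p) → refl ; (suc i , p) → refl })

Fin-sum : ∀ {n} (f : Fin n → ℕ) → Fin (sum f) ↔ Σ (Fin n) (Fin ∘ f)
Fin-sum {zero}  f = mk↔ₛ′ (λ ()) (λ ()) (λ ()) (λ ())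
Fin-sum {suc n} f = begin
  Fin (f zero + sum (f ∘ suc))               ↔⟨ Finₚ.+↔⊎ ⟩
  (Fin (f zero) ⊎ Fin (sum (f ∘ suc)))       ↔⟨ ↔-refl ⊎-↔ Fin-sum (f ∘ suc) ⟩
  (Fin (f zero) ⊎ Σ (Fin n) (Fin ∘ f ∘ suc)) ↔⟨ Σ-Fin-suc ⟨
  Σ (Fin (suc n)) (Fin ∘ f)                  ∎
  where open EquationalReasoning

finite-subset : ∀ {c} {P : A → Set} → Fin c ↔ A → (∀ a → Dec (P a)) → (∀ a → Irrelevant (P a)) →
                ∃ λ c′ → Fin c′ ↔ Σ A P
finite-subset {c = c} {P} e P? irr =
  let c′ , sub = finite-subsetFin c (P? ∘ to) (irr ∘ to) in c′ , ↔-trans sub (Σ-↔ e ↔-refl)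
  where
  open Inverse e using (to)
  finite-subsetFin : ∀ c {Q : Fin c → Set} → (∀ i → Dec (Q i)) → (∀ i → Irrelevant (Q i)) →
                     ∃ λ c′ → Fin c′ ↔ Σ (Fin c) Q
  finite-subsetFin zero    Q? irrQ = 0 , mk↔ₛ′ (λ ()) (λ ()) (λ ()) (λ ())
  finite-subsetFin (suc c) {Q} Q? irrQ with finite-subsetFin c (Q? ∘ suc) (irrQ ∘ suc) | Q? zero
  ... | c′ , sub | yes q = suc c′ , (begin
    Fin (suc c′)                   ↔⟨ Finₚ.+↔⊎ ⟩
    (Fin 1 ⊎ Fin c′)               ↔⟨ irrelevant-↔ (λ { zero zero → refl }) (irrQ zero) (λ _ → q) (λ _ → zero) ⊎-↔ sub ⟩
    (Q zero ⊎ Σ (Fin c) (Q ∘ suc)) ↔⟨ Σ-Fin-suc ⟨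
    Σ (Fin (suc c)) Q              ∎)
    where open EquationalReasoning
  ... | c′ , sub | no ¬q = c′ , (begin
    Fin c′                         ↔⟨ sub ⟩
    Σ (Fin c) (Q ∘ suc)            ↔⟨ ⊎-dropˡ ¬q ⟨
    (Q zero ⊎ Σ (Fin c) (Q ∘ suc)) ↔⟨ Σ-Fin-suc ⟨
    Σ (Fin (suc c)) Q              ∎)
    where open EquationalReasoning

Σ-≡-irrelevant : ∀ {P : A → Set} → (∀ a → Irrelevant (P a)) → {u v : Σ A P} → proj₁ u ≡ proj₁ v → u ≡ v
Σ-≡-irrelevant irr {a , p} {.a , q} refl = cong (a ,_) (irr a p q)

Σ-ℕ×-zero : ∀ {R : ℕ × A → Set} → (∀ a x → ¬ R (suc a , x)) → Σ (ℕ × A) R ↔ Σ A (λ x → R (0 , x))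
Σ-ℕ×-zero {R = R} ¬R[suc] = mk↔ₛ′ to (λ (x , r) → (0 , x) , r) (λ _ → refl) from∘to
  where
  to : Σ (ℕ × _) R → Σ _ (λ x → R (0 , x))
  to ((zero  , x) , r) = x , r
  to ((suc a , x) , r) = ⊥-elim (¬R[suc] a x r)
  from∘to : ∀ y → ((0 , proj₁ (to y)) , proj₂ (to y)) ≡ y
  from∘to ((zero  , x) , r) = refl
  from∘to ((suc a , x) , r) = ⊥-elim (¬R[suc] a x r)

-- Sequences and their generating functions

Seq : Set
Seq = ℕ → ℤ

partialSums : Seq → Seq
partialSums f r = sumTo r f

delayBy : A → ℕ → (ℕ → A) → ℕ → A
delayBy z zero    f r       = f r
delayBy z (suc j) f zero    = z
delayBy z (suc j) f (suc r) = delayBy z j f r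

delayBy-map : ∀ (h : A → B) z j f r → h (delayBy z j f r) ≡ delayBy (h z) j (h ∘ f) r
delayBy-map h z zero    f r       = refl
delayBy-map h z (suc j) f zero    = refl
delayBy-map h z (suc j) f (suc r) = delayBy-map h z j f r

delay : ℕ → Seq → Seq
delay = delayBy (+ 0)

_⊝_ : Seq → Seq → Seq
(f ⊝ g) r = f r ℤ.- g r

sumTo-cong : ∀ u {f g : Seq} → f ≗ g → sumTo u f ≡ sumTo u g
sumTo-cong zero    f≗g = f≗g 0
sumTo-cong (suc u) f≗g = cong₂ ℤ._+_ (sumTo-cong u f≗g) (f≗g (suc u))

sumTo-⊝ : ∀ u (f g : Seq) → sumTo u (f ⊝ g) ≡ sumTo u f ℤ.- sumTo u g
sumTo-⊝ zero    f g = refl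
sumTo-⊝ (suc u) f g = begin
  sumTo u (f ⊝ g) ℤ.+ (f (suc u) ℤ.- g (suc u))           ≡⟨ cong (ℤ._+ (f (suc u) ℤ.- g (suc u))) (sumTo-⊝ u f g) ⟩
  (sumTo u f ℤ.- sumTo u g) ℤ.+ (f (suc u) ℤ.- g (suc u)) ≡⟨ regroup (sumTo u f) (sumTo u g) (f (suc u)) (g (suc u)) ⟩
  sumTo (suc u) f ℤ.- sumTo (suc u) g                     ∎
  where
  open ≡-Reasoning
  regroup : ∀ a b c d → (a ℤ.- b) ℤ.+ (c ℤ.- d) ≡ (a ℤ.+ c) ℤ.- (b ℤ.+ d)
  regroup = solve-∀

delay-cong : ∀ j {f g : Seq} → f ≗ g → delay j f ≗ delay j g
delay-cong zero    f≗g r       = f≗g r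
delay-cong (suc j) f≗g zero    = refl
delay-cong (suc j) f≗g (suc r) = delay-cong j f≗g r

delay-delay : ∀ a b f → delay a (delay b f) ≗ delay (a + b) f
delay-delay zero    b f r       = refl
delay-delay (suc a) b f zero    = refl
delay-delay (suc a) b f (suc r) = delay-delay a b f r

delay-comm : ∀ a b f → delay a (delay b f) ≗ delay b (delay a f)
delay-comm a b f r = begin
  delay a (delay b f) r ≡⟨ delay-delay a b f r ⟩
  delay (a + b) f r     ≡⟨ cong (λ t → delay t f r) (ℕₚ.+-comm a b) ⟩
  delay (b + a) f r     ≡⟨ delay-delay b a f r ⟨
  delay b (delay a f) r ∎
  where open ≡-Reasoning

delay-⊝ : ∀ j f g → delay j (f ⊝ g) ≗ delay j f ⊝ delay j g
delay-⊝ zero    f g r       = refl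
delay-⊝ (suc j) f g zero    = refl
delay-⊝ (suc j) f g (suc r) = delay-⊝ j f g r

partialSums-delay : ∀ j f → partialSums (delay j f) ≗ delay j (partialSums f)
partialSums-delay zero    f r       = refl
partialSums-delay (suc j) f zero    = refl
partialSums-delay (suc j) f (suc r) =
  trans (sumTo-delay-suc r) (partialSums-delay j f r)
  where
  sumTo-delay-suc : ∀ r → sumTo (suc r) (delay (suc j) f) ≡ sumTo r (delay j f)
  sumTo-delay-suc zero    = ℤₚ.+-identityˡ _
  sumTo-delay-suc (suc r) = cong (ℤ._+ delay j f (suc r)) (sumTo-delay-suc r)

partialSums-last : ∀ f r → partialSums f r ≡ delay 1 (partialSums f) r ℤ.+ f r
partialSums-last f zero    = sym (ℤₚ.+-identityˡ _)
partialSums-last f (suc r) = refl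

sumℤ-delay : ∀ L f r → sumℤ (λ (c : Fin L) → delay (toℕ c) f r) ≡ partialSums f r ℤ.- delay L (partialSums f) r
sumℤ-delay zero    f r = sym (ℤₚ.+-inverseʳ (partialSums f r))
sumℤ-delay (suc L) f r = begin
  f r ℤ.+ sumℤ {L} (λ c → delay (suc (toℕ c)) f r)
    ≡⟨ cong (ℤ._+_ (f r)) (sumℤ-cong {L} (λ c → delay-suc (toℕ c))) ⟩
  f r ℤ.+ sumℤ {L} (λ c → delay (toℕ c) (delay 1 f) r)
    ≡⟨ cong (ℤ._+_ (f r)) (sumℤ-delay L (delay 1 f) r) ⟩
  f r ℤ.+ (partialSums (delay 1 f) r ℤ.- delay L (partialSums (delay 1 f)) r)
    ≡⟨ cong₂ (λ a b → f r ℤ.+ (a ℤ.- b)) (partialSums-delay 1 f r)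
             (trans (delay-cong L (partialSums-delay 1 f) r) (delay-delay L 1 (partialSums f) r)) ⟩
  f r ℤ.+ (delay 1 (partialSums f) r ℤ.- delay (L + 1) (partialSums f) r)
    ≡⟨ regroup (f r) (delay 1 (partialSums f) r) (delay (L + 1) (partialSums f) r) ⟩
  (delay 1 (partialSums f) r ℤ.+ f r) ℤ.- delay (L + 1) (partialSums f) r
    ≡⟨ cong₂ ℤ._-_ (partialSums-last f r) (cong (λ t → delay t (partialSums f) r) (ℕₚ.+-comm 1 L)) ⟨
  partialSums f r ℤ.- delay (suc L) (partialSums f) r ∎
  where
  open ≡-Reasoning
  delay-suc : ∀ c → delay (suc c) f r ≡ delay c (delay 1 f) r
  delay-suc c = trans (sym (delay-delay 1 c f r)) (delay-comm 1 c f r)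
  regroup : ∀ a b c → a ℤ.+ (b ℤ.- c) ≡ (b ℤ.+ a) ℤ.- c
  regroup = solve-∀

-- On generating functions Δ is multiplication by 1 − x^L.
module Difference (L : ℕ) where

  Δ : Seq → Seq
  Δ f = f ⊝ delay L f

  Δ^ : ℕ → Seq → Seq
  Δ^ n f = fold f Δ n

  Δ-cong : ∀ {f g} → f ≗ g → Δ f ≗ Δ g
  Δ-cong f≗g r = cong₂ ℤ._-_ (f≗g r) (delay-cong L f≗g r)

  Δ^-cong : ∀ n {f g} → f ≗ g → Δ^ n f ≗ Δ^ n g
  Δ^-cong zero    f≗g = f≗g
  Δ^-cong (suc n) f≗g = Δ-cong (Δ^-cong n f≗g)

  partialSums-Δ : ∀ f → partialSums (Δ f) ≗ Δ (partialSums f)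
  partialSums-Δ f r =
    trans (sumTo-⊝ r f (delay L f)) (cong (ℤ._-_ (partialSums f r)) (partialSums-delay L f r))

  partialSums-Δ^ : ∀ n f → partialSums (Δ^ n f) ≗ Δ^ n (partialSums f)
  partialSums-Δ^ zero    f r = refl
  partialSums-Δ^ (suc n) f r = trans (partialSums-Δ (Δ^ n f) r) (Δ-cong (partialSums-Δ^ n f) r)

  delay-Δ : ∀ j f → delay j (Δ f) ≗ Δ (delay j f)
  delay-Δ j f r = trans (delay-⊝ j f (delay L f) r) (cong (ℤ._-_ (delay j f r)) (delay-comm j L f r))

  delay-Δ^ : ∀ n j f → delay j (Δ^ n f) ≗ Δ^ n (delay j f)
  delay-Δ^ zero    j f r = refl
  delay-Δ^ (suc n) j f r = trans (delay-Δ j (Δ^ n f) r) (Δ-cong (delay-Δ^ n j f) r)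

-- binom i has generating function 1/(1 − x)^(i+1).
binom : ℕ → Seq
binom i r = + ((r + i) C i)

partialSums-binom : ∀ i → partialSums (binom i) ≗ binom (suc i)
partialSums-binom i zero    = cong +_ (trans (nCn≡1 i) (sym (nCn≡1 (suc i))))
partialSums-binom i (suc r) = begin
  partialSums (binom i) r ℤ.+ binom i (suc r)     ≡⟨ cong (ℤ._+ binom i (suc r)) (partialSums-binom i r) ⟩
  + ((r + suc i) C suc i) ℤ.+ + ((suc r + i) C i) ≡⟨ ℤₚ.pos-+ ((r + suc i) C suc i) ((suc r + i) C i) ⟨
  + ((r + suc i) C suc i + (suc r + i) C i)       ≡⟨ cong +_ pascal ⟩
  binom (suc i) (suc r)                           ∎
  where
  open ≡-Reasoning
  pascal : (r + suc i) C suc i + (suc r + i) C i ≡ (suc r + suc i) C suc i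
  pascal rewrite sym (ℕₚ.+-suc r i) =
    trans (ℕₚ.+-comm ((r + suc i) C suc i) _) (nCk+nC[k+1]≡[n+1]C[k+1] (r + suc i) i)

delay-binom : ∀ i j r → 1 ≤ i → delay j (binom i) r ≡ + ((r + i ∸ j) C i)
delay-binom i       zero    r       _   = refl
delay-binom (suc i) (suc j) zero    _   = sym (cong +_ (k>n⇒nCk≡0 (s≤s (ℕₚ.m∸n≤m i j))))
delay-binom i       (suc j) (suc r) 1≤i = delay-binom i j r 1≤i

altSum : ℕ → ℕ → (ℕ → ℤ) → ℤ
altSum u n x = sumTo u (λ k → sgn k ℤ.* (+ (n C k) ℤ.* x k))

altSum-pascal : ∀ u n x → altSum (suc u) (suc n) x ≡ altSum (suc u) n x ℤ.- altSum u n (λ k → x (suc k))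
altSum-pascal zero n x = trans
  (cong (λ c → + 1 ℤ.* (+ 1 ℤ.* x 0) ℤ.+ - + 1 ℤ.* (+ c ℤ.* x 1)) (sym (nCk+nC[k+1]≡[n+1]C[k+1] n 0)))
  (trans (cong (λ c → + 1 ℤ.* (+ 1 ℤ.* x 0) ℤ.+ - + 1 ℤ.* (c ℤ.* x 1)) (ℤₚ.pos-+ 1 (n C 1)))
         (regroup (x 0) (x 1) (+ (n C 1))))
  where
  regroup : ∀ a b c → + 1 ℤ.* (+ 1 ℤ.* a) ℤ.+ - + 1 ℤ.* ((+ 1 ℤ.+ c) ℤ.* b)
          ≡ (+ 1 ℤ.* (+ 1 ℤ.* a) ℤ.+ - + 1 ℤ.* (c ℤ.* b)) ℤ.- + 1 ℤ.* (+ 1 ℤ.* b)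
  regroup = solve-∀
altSum-pascal (suc u) n x = begin
  altSum (suc u) (suc n) x ℤ.+ - s ℤ.* (+ (suc n C suc (suc u)) ℤ.* x₊)
    ≡⟨ cong₂ (λ a c → a ℤ.+ - s ℤ.* (c ℤ.* x₊)) (altSum-pascal u n x)
             (trans (cong +_ (sym (nCk+nC[k+1]≡[n+1]C[k+1] n (suc u)))) (ℤₚ.pos-+ (n C suc u) (n C suc (suc u)))) ⟩
  (altSum (suc u) n x ℤ.- altSum u n (λ k → x (suc k))) ℤ.+ - s ℤ.* ((+ (n C suc u) ℤ.+ + (n C suc (suc u))) ℤ.* x₊)
    ≡⟨ regroup (altSum (suc u) n x) (altSum u n (λ k → x (suc k))) s (+ (n C suc u)) (+ (n C suc (suc u))) x₊ ⟩
  altSum (suc (suc u)) n x ℤ.- altSum (suc u) n (λ k → x (suc k))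
    ∎
  where
  open ≡-Reasoning
  s  = sgn (suc u)
  x₊ = x (suc (suc u))
  regroup : ∀ a b s c₁ c₂ y → (a ℤ.- b) ℤ.+ - s ℤ.* ((c₁ ℤ.+ c₂) ℤ.* y)
          ≡ (a ℤ.+ - s ℤ.* (c₂ ℤ.* y)) ℤ.- (b ℤ.+ s ℤ.* (c₁ ℤ.* y))
  regroup = solve-∀

altSum-overflow : ∀ n x → altSum (suc n) n x ≡ altSum n n x
altSum-overflow n x = begin
  altSum n n x ℤ.+ sgn (suc n) ℤ.* (+ (n C suc n) ℤ.* x (suc n))
    ≡⟨ cong (λ c → altSum n n x ℤ.+ sgn (suc n) ℤ.* (+ c ℤ.* x (suc n))) (k>n⇒nCk≡0 (ℕₚ.n<1+n n)) ⟩
  altSum n n x ℤ.+ sgn (suc n) ℤ.* + 0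
    ≡⟨ cong (ℤ._+_ (altSum n n x)) (ℤₚ.*-zeroʳ (sgn (suc n))) ⟩
  altSum n n x ℤ.+ + 0
    ≡⟨ ℤₚ.+-identityʳ _ ⟩
  altSum n n x ∎
  where open ≡-Reasoning

module _ (L : ℕ) where
  open Difference L

  Δ^-expansion : ∀ n g r → Δ^ n g r ≡ altSum n n (λ k → delay (k * L) g r)
  Δ^-expansion zero    g r = sym (trans (ℤₚ.*-identityˡ _) (ℤₚ.*-identityˡ _))
  Δ^-expansion (suc n) g r = begin
    Δ^ n g r ℤ.- delay L (Δ^ n g) r
      ≡⟨ cong (ℤ._-_ (Δ^ n g r)) (delay-Δ^ n L g r) ⟩
    Δ^ n g r ℤ.- Δ^ n (delay L g) r
      ≡⟨ cong₂ ℤ._-_ (Δ^-expansion n g r) (Δ^-expansion n (delay L g) r) ⟩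
    altSum n n (term 0) ℤ.- altSum n n (λ k → delay (k * L) (delay L g) r)
      ≡⟨ cong (ℤ._-_ (altSum n n (term 0))) (sumTo-cong n (λ k → cong (λ z → sgn k ℤ.* (+ (n C k) ℤ.* z)) (delay-later k))) ⟩
    altSum n n (term 0) ℤ.- altSum n n (term 1)
      ≡⟨ cong (ℤ._- altSum n n (term 1)) (altSum-overflow n (term 0)) ⟨
    altSum (suc n) n (term 0) ℤ.- altSum n n (term 1)
      ≡⟨ altSum-pascal n n (term 0) ⟨
    altSum (suc n) (suc n) (term 0) ∎
    where
    open ≡-Reasoning
    term : ℕ → ℕ → ℤ
    term a k = delay ((a + k) * L) g r
    delay-later : ∀ k → delay (k * L) (delay L g) r ≡ term 1 k
    delay-later k = trans (delay-delay (k * L) L g r) (cong (λ t → delay t g r) (ℕₚ.+-comm (k * L) L))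

  Δ^-binom : ∀ n i r → 1 ≤ i → Δ^ n (binom i) r ≡ altSum n n (λ k → + ((r + i ∸ k * L) C i))
  Δ^-binom n i r 1≤i = trans (Δ^-expansion n (binom i) r)
    (sumTo-cong n (λ k → cong (λ z → sgn k ℤ.* (+ (n C k) ℤ.* z)) (delay-binom i (k * L) r 1≤i)))

-- Counting step sequences by width and cost

sub≡neg⇒ : ∀ a c m → + a ℤ.- + c ≡ - + m → c ≡ a + m
sub≡neg⇒ a c m e = ℤₚ.+-injective (begin
  + c                   ≡⟨ cancel (+ a) (+ c) ⟨
  + a ℤ.- (+ a ℤ.- + c) ≡⟨ cong (ℤ._-_ (+ a)) e ⟩
  + a ℤ.- - + m         ≡⟨ cong (ℤ._+_ (+ a)) (ℤₚ.neg-involutive (+ m)) ⟩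
  + a ℤ.+ + m           ≡⟨ ℤₚ.pos-+ a m ⟨
  + (a + m)             ∎)
  where
  open ≡-Reasoning
  cancel : ∀ a c → a ℤ.- (a ℤ.- c) ≡ c
  cancel = solve-∀

sub≡neg⇐ : ∀ a c m → c ≡ a + m → + a ℤ.- + c ≡ - + m
sub≡neg⇐ a c m refl = trans (cong (ℤ._-_ (+ a)) (ℤₚ.pos-+ a m)) (cancel (+ a) (+ m))
  where
  cancel : ∀ a m → a ℤ.- (a ℤ.+ m) ≡ - m
  cancel = solve-∀

module Steps (N K : ℕ) where

  L : ℕ
  L = suc (N + K)

  stepWidth : Step N K → ℕ
  stepWidth V     = 0
  stepWidth (U _) = 1
  stepWidth (D _) = 1

  -- cost s = N · stepWidth s − (height of s): the horizontal steps cost 0, 1, …, N + K.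
  cost : Step N K → ℕ
  cost V     = 1
  cost (U i) = N ∸ toℕ i
  cost (D j) = suc (N + toℕ j)

  width : List (Step N K) → ℕ
  width = sumList ∘ map stepWidth

  totalCost : List (Step N K) → ℕ
  totalCost = sumList ∘ map cost

  height : List (Step N K) → ℤ
  height p = + N ℤ.* + width p ℤ.- + totalCost p

  vec-⊕ : ∀ s p → vec s ⊕ (+ width p , height p) ≡ (+ width (s ∷ p) , height (s ∷ p))
  vec-⊕ s p = cong₂ _,_
    (trans (cong (ℤ._+ + width p) (vec₁ s)) (sym (ℤₚ.pos-+ (stepWidth s) (width p))))
    (begin
      proj₂ (vec s) ℤ.+ height p
        ≡⟨ cong (ℤ._+ height p) (vec₂ s) ⟩
      (+ N ℤ.* + stepWidth s ℤ.- + cost s) ℤ.+ (+ N ℤ.* + width p ℤ.- + totalCost p)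
        ≡⟨ regroup (+ N) (+ stepWidth s) (+ width p) (+ cost s) (+ totalCost p) ⟩
      + N ℤ.* (+ stepWidth s ℤ.+ + width p) ℤ.- (+ cost s ℤ.+ + totalCost p)
        ≡⟨ cong₂ (λ a b → + N ℤ.* a ℤ.- b) (ℤₚ.pos-+ (stepWidth s) (width p)) (ℤₚ.pos-+ (cost s) (totalCost p)) ⟨
      height (s ∷ p) ∎)
    where
    open ≡-Reasoning
    regroup : ∀ n a b c d → (n ℤ.* a ℤ.- c) ℤ.+ (n ℤ.* b ℤ.- d) ≡ n ℤ.* (a ℤ.+ b) ℤ.- (c ℤ.+ d)
    regroup = solve-∀
    vec₁ : ∀ s → proj₁ (vec s) ≡ + stepWidth s
    vec₁ V     = refl
    vec₁ (U _) = refl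
    vec₁ (D _) = refl
    vec₂ : ∀ s → proj₂ (vec s) ≡ + N ℤ.* + stepWidth s ℤ.- + cost s
    vec₂ V     = sym (cong (ℤ._- + 1) (ℤₚ.*-zeroʳ (+ N)))
    vec₂ (U i) = begin
      + toℕ i                       ≡⟨ cancel (+ N) (+ toℕ i) ⟨
      + N ℤ.- (+ N ℤ.- + toℕ i)     ≡⟨ cong₂ ℤ._-_ (ℤₚ.*-identityʳ (+ N)) pos-∸ ⟨
      + N ℤ.* + 1 ℤ.- + (N ∸ toℕ i) ∎
      where
      cancel : ∀ a b → a ℤ.- (a ℤ.- b) ≡ b
      cancel = solve-∀
      pos-∸ : + (N ∸ toℕ i) ≡ + N ℤ.- + toℕ i
      pos-∸ = sym (trans (ℤₚ.m-n≡m⊖n N (toℕ i)) (ℤₚ.⊖-≥ (Finₚ.toℕ≤pred[n] i)))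
    vec₂ (D j) = begin
      - + suc (toℕ j)                     ≡⟨ cancel (+ N) (+ toℕ j) ⟨
      + N ℤ.- (+ 1 ℤ.+ (+ N ℤ.+ + toℕ j)) ≡⟨ cong₂ ℤ._-_ (ℤₚ.*-identityʳ (+ N)) pos-suc ⟨
      + N ℤ.* + 1 ℤ.- + suc (N + toℕ j)   ∎
      where
      cancel : ∀ a b → a ℤ.- (+ 1 ℤ.+ (a ℤ.+ b)) ≡ - (+ 1 ℤ.+ b)
      cancel = solve-∀
      pos-suc : + suc (N + toℕ j) ≡ + 1 ℤ.+ (+ N ℤ.+ + toℕ j)
      pos-suc = trans (ℤₚ.pos-+ 1 (N + toℕ j)) (cong (ℤ._+_ (+ 1)) (ℤₚ.pos-+ N (toℕ j)))

  endFrom-⊕ : ∀ q p → endFrom q p ≡ q ⊕ (+ width p , height p)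
  endFrom-⊕ (x , y) []      = sym (cong₂ _,_ (ℤₚ.+-identityʳ x) (+-height-[] y (+ N)))
    where
    +-height-[] : ∀ y n → y ℤ.+ (n ℤ.* + 0 ℤ.- + 0) ≡ y
    +-height-[] = solve-∀
  endFrom-⊕ q       (s ∷ p) = begin
    endFrom (q ⊕ vec s) p                  ≡⟨ endFrom-⊕ (q ⊕ vec s) p ⟩
    (q ⊕ vec s) ⊕ (+ width p , height p)   ≡⟨ ⊕-assoc q (vec s) (+ width p , height p) ⟩
    q ⊕ (vec s ⊕ (+ width p , height p))   ≡⟨ cong (q ⊕_) (vec-⊕ s p) ⟩
    q ⊕ (+ width (s ∷ p) , height (s ∷ p)) ∎
    where
    open ≡-Reasoning
    ⊕-assoc : ∀ a b c → (a ⊕ b) ⊕ c ≡ a ⊕ (b ⊕ c)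
    ⊕-assoc (a₁ , a₂) (b₁ , b₂) (c₁ , c₂) = cong₂ _,_ (ℤₚ.+-assoc a₁ b₁ c₁) (ℤₚ.+-assoc a₂ b₂ c₂)

  endFrom-origin : ∀ p → endFrom origin p ≡ (+ width p , height p)
  endFrom-origin p = trans (endFrom-⊕ origin p) (cong₂ _,_ (ℤₚ.+-identityˡ _) (ℤₚ.+-identityˡ _))

  height≡neg⇔ : ∀ p m → height p ≡ - + m ⇔ totalCost p ≡ N * width p + m
  height≡neg⇔ p m = mk⇔
    (λ e → sub≡neg⇒ (N * width p) (totalCost p) m (trans (cong (ℤ._- + totalCost p) (ℤₚ.pos-* N (width p))) e))
    (λ e → trans (cong (ℤ._- + totalCost p) (sym (ℤₚ.pos-* N (width p)))) (sub≡neg⇐ (N * width p) (totalCost p) m e))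

  width-height⇔ : ∀ p n m → (width p ≡ n × height p ≡ - + m) ⇔ (width p ≡ n × totalCost p ≡ N * n + m)
  width-height⇔ p n m = mk⇔ (λ (w , h) → w , to w h) (λ (w , c) → w , from w c)
    where
    to : width p ≡ n → height p ≡ - + m → totalCost p ≡ N * n + m
    to refl = Equivalence.to (height≡neg⇔ p m)
    from : width p ≡ n → totalCost p ≡ N * n + m → height p ≡ - + m
    from refl = Equivalence.from (height≡neg⇔ p m)

  endFrom≡⇔ : ∀ p n m → endFrom origin p ≡ (+ n , - + m) ⇔ (width p ≡ n × totalCost p ≡ N * n + m)
  endFrom≡⇔ p n m = width-height⇔ p n m ⇔-∘ mk⇔ coordinates endpoint
    where
    coordinates : endFrom origin p ≡ (+ n , - + m) → width p ≡ n × height p ≡ - + m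
    coordinates e = let e′ = trans (sym (endFrom-origin p)) e in ℤₚ.+-injective (cong proj₁ e′) , cong proj₂ e′
    endpoint : width p ≡ n × height p ≡ - + m → endFrom origin p ≡ (+ n , - + m)
    endpoint (w , h) = trans (endFrom-origin p) (cong₂ (λ a b → (+ a , b)) w h)

  Σ-Step : ∀ {P : Step N K → Set} → Σ (Step N K) P ↔ (P V ⊎ Σ (Fin (suc N)) (P ∘ U) ⊎ Σ (Fin K) (P ∘ D))
  Σ-Step = mk↔ₛ′
    (λ { (V , p) → inj₁ p ; (U i , p) → inj₂ (inj₁ (i , p)) ; (D j , p) → inj₂ (inj₂ (j , p)) })
    (λ { (inj₁ p) → V , p ; (inj₂ (inj₁ (i , p))) → U i , p ; (inj₂ (inj₂ (j , p))) → D j , p })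
    (λ { (inj₁ p) → refl ; (inj₂ (inj₁ (i , p))) → refl ; (inj₂ (inj₂ (j , p))) → refl })
    (λ { (V , p) → refl ; (U i , p) → refl ; (D j , p) → refl })

  cost-U-opposite : ∀ i → cost (U i) ≡ toℕ (opposite i ↑ˡ K)
  cost-U-opposite i = trans (sym (Finₚ.opposite-prop i)) (sym (Finₚ.toℕ-↑ˡ (opposite i) K))

  Σ-horizontal : ∀ (P : ℕ → Set) →
    (Σ (Fin (suc N)) (P ∘ cost ∘ U) ⊎ Σ (Fin K) (P ∘ cost ∘ D)) ↔ Σ (Fin L) (P ∘ toℕ)
  Σ-horizontal P = begin
    (Σ (Fin (suc N)) (P ∘ cost ∘ U) ⊎ Σ (Fin K) (P ∘ cost ∘ D))
      ↔⟨ Σ-↔ opposite↔ (λ {i} → ≡⇒↔ P (cost-U-opposite i))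
         ⊎-↔ Σ-↔ ↔-refl (λ {j} → ≡⇒↔ P (sym (Finₚ.toℕ-↑ʳ (suc N) j))) ⟩
    (Σ (Fin (suc N)) (λ i → P (toℕ (i ↑ˡ K))) ⊎ Σ (Fin K) (λ j → P (toℕ (suc N ↑ʳ j))))
      ↔⟨ Σ-distribʳ-⊎ ⟨
    Σ (Fin (suc N) ⊎ Fin K) (P ∘ toℕ ∘ join (suc N) K)
      ↔⟨ Σ-↔ (↔-sym Finₚ.+↔⊎) ↔-refl ⟩
    Σ (Fin L) (P ∘ toℕ) ∎
    where
    open EquationalReasoning
    opposite↔ : Fin (suc N) ↔ Fin (suc N)
    opposite↔ = mk↔ₛ′ opposite opposite Finₚ.opposite-involutive Finₚ.opposite-involutive

  Words : ℕ → ℕ → ℕ → Set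
  Words n c r = Σ (List (Step N K)) λ p → width p ≡ n × c + totalCost p ≡ r

  Tails : ℕ → ℕ → ℕ → Set
  Tails n c r = Σ (List (Step N K)) λ p → suc (width p) ≡ n × c + totalCost p ≡ r

  F↔Words : ∀ m n → F N K m n ↔ Words n 0 (N * n + m)
  F↔Words m n = Σ-↔ ↔-refl (λ {p} → irrelevant-↔ ≡-irrelevant ≡×≡-irrelevant
    (Equivalence.to (endFrom≡⇔ p n m)) (Equivalence.from (endFrom≡⇔ p n m)))

  Words-uncons : ∀ n r → Words n 0 r ↔ ((0 ≡ n × 0 ≡ r) ⊎ Words n 1 r ⊎ Σ (Fin L) (λ c → Tails n (toℕ c) r))
  Words-uncons n r = begin
    Words n 0 r
      ↔⟨ Σ-List ⟩
    ((0 ≡ n × 0 ≡ r) ⊎ Σ (Step N K) (λ s → Σ (List (Step N K)) λ p → width (s ∷ p) ≡ n × totalCost (s ∷ p) ≡ r))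
      ↔⟨ ↔-refl ⊎-↔ Σ-Step ⟩
    ((0 ≡ n × 0 ≡ r) ⊎ Words n 1 r ⊎ Σ (Fin (suc N)) (λ i → Tails n (cost (U i)) r) ⊎ Σ (Fin K) (λ j → Tails n (cost (D j)) r))
      ↔⟨ ↔-refl ⊎-↔ ↔-refl ⊎-↔ Σ-horizontal (λ c → Tails n c r) ⟩
    ((0 ≡ n × 0 ≡ r) ⊎ Words n 1 r ⊎ Σ (Fin L) (λ c → Tails n (toℕ c) r)) ∎
    where open EquationalReasoning

  Words-delay : ∀ n c r → Words n (suc c) (suc r) ↔ Words n c r
  Words-delay n c r = Σ-↔ ↔-refl (irrelevant-↔ ≡×≡-irrelevant ≡×≡-irrelevant
    (λ (w , e) → w , ℕₚ.suc-injective e) (λ (w , e) → w , cong suc e))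

  Words-empty : ∀ n c → ¬ Words n (suc c) 0
  Words-empty n c (_ , _ , ())

  Tails-suc : ∀ n c r → Tails (suc n) c r ↔ Words n c r
  Tails-suc n c r = Σ-↔ ↔-refl (irrelevant-↔ ≡×≡-irrelevant ≡×≡-irrelevant
    (λ (w , e) → ℕₚ.suc-injective w , e) (λ (w , e) → cong suc w , e))

  Tails-zero : ∀ c r → ¬ Tails 0 c r
  Tails-zero c r (_ , () , _)

  mutual
    wordCount : ℕ → ℕ → ℕ
    wordCount zero    r       = 1
    wordCount (suc n) zero    = ledCount n zero
    wordCount (suc n) (suc r) = wordCount (suc n) r + ledCount n (suc r)

    -- counts the words of width n + 1 that start with a horizontal step
    ledCount : ℕ → ℕ → ℕ
    ledCount n r = sum λ (c : Fin L) → delayBy 0 (toℕ c) (wordCount n) r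

  mutual
    wordCount-words : ∀ n r → Fin (wordCount n r) ↔ Words n 0 r
    wordCount-words zero zero = begin
      Fin 1
        ↔⟨ irrelevant-↔ (λ { zero zero → refl }) ≡×≡-irrelevant (λ _ → refl , refl) (λ _ → zero) ⟩
      (0 ≡ 0 × 0 ≡ 0)
        ↔⟨ ⊎-dropʳ (λ { (inj₁ w) → Words-empty 0 0 w ; (inj₂ (_ , t)) → Tails-zero _ 0 t }) ⟨
      ((0 ≡ 0 × 0 ≡ 0) ⊎ Words 0 1 0 ⊎ Σ (Fin L) (λ c → Tails 0 (toℕ c) 0))
        ↔⟨ Words-uncons 0 0 ⟨
      Words 0 0 0 ∎
      where open EquationalReasoning
    wordCount-words zero (suc r) = begin
      Fin 1
        ↔⟨ wordCount-words 0 r ⟩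
      Words 0 0 r
        ↔⟨ Words-delay 0 0 r ⟨
      Words 0 1 (suc r)
        ↔⟨ ⊎-dropʳ (λ (_ , t) → Tails-zero _ (suc r) t) ⟨
      (Words 0 1 (suc r) ⊎ Σ (Fin L) (λ c → Tails 0 (toℕ c) (suc r)))
        ↔⟨ ⊎-dropˡ (λ ()) ⟨
      ((0 ≡ 0 × 0 ≡ suc r) ⊎ Words 0 1 (suc r) ⊎ Σ (Fin L) (λ c → Tails 0 (toℕ c) (suc r)))
        ↔⟨ Words-uncons 0 (suc r) ⟨
      Words 0 0 (suc r) ∎
      where open EquationalReasoning
    wordCount-words (suc n) zero = begin
      Fin (ledCount n 0)
        ↔⟨ ledCount-tails n 0 ⟩
      Σ (Fin L) (λ c → Tails (suc n) (toℕ c) 0)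
        ↔⟨ ⊎-dropˡ (Words-empty (suc n) 0) ⟨
      (Words (suc n) 1 0 ⊎ Σ (Fin L) (λ c → Tails (suc n) (toℕ c) 0))
        ↔⟨ ⊎-dropˡ (λ ()) ⟨
      ((0 ≡ suc n × 0 ≡ 0) ⊎ Words (suc n) 1 0 ⊎ Σ (Fin L) (λ c → Tails (suc n) (toℕ c) 0))
        ↔⟨ Words-uncons (suc n) 0 ⟨
      Words (suc n) 0 0 ∎
      where open EquationalReasoning
    wordCount-words (suc n) (suc r) = begin
      Fin (wordCount (suc n) r + ledCount n (suc r))
        ↔⟨ Finₚ.+↔⊎ ⟩
      (Fin (wordCount (suc n) r) ⊎ Fin (ledCount n (suc r)))
        ↔⟨ ↔-trans (wordCount-words (suc n) r) (↔-sym (Words-delay (suc n) 0 r)) ⊎-↔ ledCount-tails n (suc r) ⟩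
      (Words (suc n) 1 (suc r) ⊎ Σ (Fin L) (λ c → Tails (suc n) (toℕ c) (suc r)))
        ↔⟨ ⊎-dropˡ (λ ()) ⟨
      ((0 ≡ suc n × 0 ≡ suc r) ⊎ Words (suc n) 1 (suc r) ⊎ Σ (Fin L) (λ c → Tails (suc n) (toℕ c) (suc r)))
        ↔⟨ Words-uncons (suc n) (suc r) ⟨
      Words (suc n) 0 (suc r) ∎
      where open EquationalReasoning

    ledCount-tails : ∀ n r → Fin (ledCount n r) ↔ Σ (Fin L) (λ c → Tails (suc n) (toℕ c) r)
    ledCount-tails n r = ↔-trans (Fin-sum _)
      (Σ-↔ ↔-refl (λ {c} → ↔-trans (delayed-words n (toℕ c) r) (↔-sym (Tails-suc n (toℕ c) r))))

    delayed-words : ∀ n c r → Fin (delayBy 0 c (wordCount n) r) ↔ Words n c r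
    delayed-words n zero    r       = wordCount-words n r
    delayed-words n (suc c) zero    = mk↔ₛ′ (λ ()) (λ w → ⊥-elim (Words-empty n c w)) (λ w → ⊥-elim (Words-empty n c w)) (λ ())
    delayed-words n (suc c) (suc r) = ↔-trans (delayed-words n c r) (↔-sym (Words-delay n c r))

  open Difference L

  ledCount-partialSums : ∀ n → +_ ∘ ledCount n ≗ partialSums (Δ (+_ ∘ wordCount n))
  ledCount-partialSums n r = begin
    + sum {L} (λ c → delayBy 0 (toℕ c) (wordCount n) r)  ≡⟨ pos-sum {L} (λ c → delayBy 0 (toℕ c) (wordCount n) r) ⟩
    sumℤ {L} (λ c → + delayBy 0 (toℕ c) (wordCount n) r) ≡⟨ sumℤ-cong {L} (λ c → delayBy-map +_ 0 (toℕ c) (wordCount n) r) ⟩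
    sumℤ {L} (λ c → delay (toℕ c) (+_ ∘ wordCount n) r)  ≡⟨ sumℤ-delay L (+_ ∘ wordCount n) r ⟩
    Δ (partialSums (+_ ∘ wordCount n)) r                 ≡⟨ partialSums-Δ (+_ ∘ wordCount n) r ⟨
    partialSums (Δ (+_ ∘ wordCount n)) r                 ∎
    where
    open ≡-Reasoning
    pos-sum : ∀ {m} (f : Fin m → ℕ) → + sum f ≡ sumℤ (+_ ∘ f)
    pos-sum {zero}  f = refl
    pos-sum {suc m} f = trans (ℤₚ.pos-+ (f zero) (sum (f ∘ suc))) (cong (ℤ._+_ (+ f zero)) (pos-sum (f ∘ suc)))

  wordCount-suc : ∀ n → +_ ∘ wordCount (suc n) ≗ partialSums (+_ ∘ ledCount n)
  wordCount-suc n zero    = refl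
  wordCount-suc n (suc r) =
    trans (ℤₚ.pos-+ (wordCount (suc n) r) (ledCount n (suc r))) (cong (ℤ._+ + ledCount n (suc r)) (wordCount-suc n r))

  mutual
    wordCount-Δ^ : ∀ n → +_ ∘ wordCount n ≗ Δ^ n (binom (2 * n))
    wordCount-Δ^ zero    r = refl
    wordCount-Δ^ (suc n) r = begin
      + wordCount (suc n) r                            ≡⟨ wordCount-suc n r ⟩
      partialSums (+_ ∘ ledCount n) r                  ≡⟨ sumTo-cong r (ledCount-Δ^ n) ⟩
      partialSums (Δ^ (suc n) (binom (suc (2 * n)))) r ≡⟨ partialSums-Δ^ (suc n) (binom (suc (2 * n))) r ⟩
      Δ^ (suc n) (partialSums (binom (suc (2 * n)))) r ≡⟨ Δ^-cong (suc n) (partialSums-binom (suc (2 * n))) r ⟩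
      Δ^ (suc n) (binom (suc (suc (2 * n)))) r         ≡⟨ cong (λ i → Δ^ (suc n) (binom i) r) (ℕₚ.*-suc 2 n) ⟨
      Δ^ (suc n) (binom (2 * suc n)) r                 ∎
      where open ≡-Reasoning

    ledCount-Δ^ : ∀ n → +_ ∘ ledCount n ≗ Δ^ (suc n) (binom (suc (2 * n)))
    ledCount-Δ^ n r = begin
      + ledCount n r                             ≡⟨ ledCount-partialSums n r ⟩
      partialSums (Δ (+_ ∘ wordCount n)) r       ≡⟨ sumTo-cong r (Δ-cong (wordCount-Δ^ n)) ⟩
      partialSums (Δ^ (suc n) (binom (2 * n))) r ≡⟨ partialSums-Δ^ (suc n) (binom (2 * n)) r ⟩
      Δ^ (suc n) (partialSums (binom (2 * n))) r ≡⟨ Δ^-cong (suc n) (partialSums-binom (2 * n)) r ⟩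
      Δ^ (suc n) (binom (suc (2 * n))) r         ∎
      where open ≡-Reasoning

  wordCount-formula : ∀ n r → 1 ≤ n → + wordCount n r ≡ altSum n n (λ k → + ((r + 2 * n ∸ k * L) C (2 * n)))
  wordCount-formula n r 1≤n = trans (wordCount-Δ^ n r) (Δ^-binom L n (2 * n) r (ℕₚ.≤-trans 1≤n (ℕₚ.m≤m+n n _)))

  ledCount-formula : ∀ n r → + ledCount n r ≡ altSum (suc n) (suc n) (λ k → + ((r + suc (2 * n) ∸ k * L) C suc (2 * n)))
  ledCount-formula n r = trans (ledCount-Δ^ n r) (Δ^-binom L (suc n) (suc (2 * n)) r (s≤s z≤n))

-- The cycle lemma

total : List ℤ → ℤ
total = foldr ℤ._+_ (+ 0)

total-++ : ∀ xs ys → total (xs ++ ys) ≡ total xs ℤ.+ total ys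
total-++ []       ys = sym (ℤₚ.+-identityˡ _)
total-++ (x ∷ xs) ys = trans (cong (ℤ._+_ x) (total-++ xs ys)) (sym (ℤₚ.+-assoc x (total xs) (total ys)))

StaysAbove : ℤ → List ℤ → Set
StaysAbove y []       = ⊤
StaysAbove y (x ∷ xs) = + 0 ℤ.≤ y × StaysAbove (y ℤ.+ x) xs

StaysAbove-irrelevant : ∀ y xs → Irrelevant (StaysAbove y xs)
StaysAbove-irrelevant y []       tt tt = refl
StaysAbove-irrelevant y (x ∷ xs) = ×-irrelevant ℤₚ.≤-irrelevant (StaysAbove-irrelevant (y ℤ.+ x) xs)

StaysAbove? : ∀ y xs → Dec (StaysAbove y xs)
StaysAbove? y []       = yes tt
StaysAbove? y (x ∷ xs) with + 0 ℤₚ.≤? y | StaysAbove? (y ℤ.+ x) xs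
... | yes 0≤y | yes rest = yes (0≤y , rest)
... | no  0≰y | _        = no (0≰y ∘′ proj₁)
... | yes _   | no ¬rest = no (¬rest ∘′ proj₂)

StaysAbove-++⁻ : ∀ y xs ys → StaysAbove y (xs ++ ys) → StaysAbove y xs × StaysAbove (y ℤ.+ total xs) ys
StaysAbove-++⁻ y []       ys above = tt , subst (λ z → StaysAbove z ys) (sym (ℤₚ.+-identityʳ y)) above
StaysAbove-++⁻ y (x ∷ xs) ys (0≤y , above) =
  let aboveˡ , aboveʳ = StaysAbove-++⁻ (y ℤ.+ x) xs ys above
  in (0≤y , aboveˡ) , subst (λ z → StaysAbove z ys) (ℤₚ.+-assoc y x (total xs)) aboveʳ

StaysAbove-++⁺ : ∀ y xs ys → StaysAbove y xs → StaysAbove (y ℤ.+ total xs) ys → StaysAbove y (xs ++ ys)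
StaysAbove-++⁺ y []       ys _             above = subst (λ z → StaysAbove z ys) (ℤₚ.+-identityʳ y) above
StaysAbove-++⁺ y (x ∷ xs) ys (0≤y , aboveˡ) aboveʳ =
  0≤y , StaysAbove-++⁺ (y ℤ.+ x) xs ys aboveˡ (subst (λ z → StaysAbove z ys) (sym (ℤₚ.+-assoc y x (total xs))) aboveʳ)

StaysAbove-split : ∀ y xs ys → 0 < length ys → StaysAbove y (xs ++ ys) → + 0 ℤ.≤ y ℤ.+ total xs
StaysAbove-split y xs (_ ∷ _) _ above = proj₁ (proj₂ (StaysAbove-++⁻ y xs _ above))

StaysAbove-prefixes : ∀ y xs → (∀ t → t < length xs → + 0 ℤ.≤ y ℤ.+ total (take t xs)) → StaysAbove y xs
StaysAbove-prefixes y []       _        = tt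
StaysAbove-prefixes y (x ∷ xs) prefix≥0 =
  subst (+ 0 ℤ.≤_) (ℤₚ.+-identityʳ y) (prefix≥0 0 (s≤s z≤n)) ,
  StaysAbove-prefixes (y ℤ.+ x) xs (λ t t< → subst (+ 0 ℤ.≤_) (sym (ℤₚ.+-assoc y x _)) (prefix≥0 (suc t) (s≤s t<)))

StaysAbove-≥-1 : ∀ z xs → StaysAbove z xs → z ℤ.+ total xs ≡ - + 1 → - + 1 ℤ.≤ z
StaysAbove-≥-1 z []      _           z+0≡-1 = ℤₚ.≤-reflexive (trans (sym z+0≡-1) (ℤₚ.+-identityʳ z))
StaysAbove-≥-1 z (_ ∷ _) (0≤z , _) _      = ℤₚ.≤-trans (ℤ.-≤+ {0} {0}) 0≤z

z-1-a≡z-[1+a] : ∀ z a → (z ℤ.+ - + 1) ℤ.- + a ≡ z ℤ.- + suc a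
z-1-a≡z-[1+a] z a = trans (regroup z (+ a)) (cong (λ b → z ℤ.- b) (sym (ℤₚ.pos-+ 1 a)))
  where
  regroup : ∀ z a → (z ℤ.+ - + 1) ℤ.- a ≡ z ℤ.- (+ 1 ℤ.+ a)
  regroup = solve-∀

module _ {rest : List ℤ} where

  StaysAbove-descent⁻ : ∀ z a → StaysAbove z (replicate a (- + 1) ++ rest) → StaysAbove (z ℤ.- + a) rest
  StaysAbove-descent⁻ z zero    above       = subst (λ y → StaysAbove y rest) (sym (ℤₚ.+-identityʳ z)) above
  StaysAbove-descent⁻ z (suc a) (_ , above) =
    subst (λ y → StaysAbove y rest) (z-1-a≡z-[1+a] z a) (StaysAbove-descent⁻ (z ℤ.+ - + 1) a above)

  StaysAbove-descent⁺ : ∀ z a → - + 1 ℤ.≤ z ℤ.- + a → StaysAbove (z ℤ.- + a) rest →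
                        StaysAbove z (replicate a (- + 1) ++ rest)
  StaysAbove-descent⁺ z zero    _     above = subst (λ y → StaysAbove y rest) (ℤₚ.+-identityʳ z) above
  StaysAbove-descent⁺ z (suc a) -1≤end above =
    0≤z , StaysAbove-descent⁺ (z ℤ.+ - + 1) a (subst (- + 1 ℤ.≤_) (sym (z-1-a≡z-[1+a] z a)) -1≤end)
                              (subst (λ y → StaysAbove y rest) (sym (z-1-a≡z-[1+a] z a)) above)
    where
    0≤z : + 0 ℤ.≤ z
    0≤z = begin
      + 0                         ≡⟨ ℤₚ.+-inverseˡ (+ 1) ⟨
      - + 1 ℤ.+ + 1               ≤⟨ ℤₚ.+-mono-≤ -1≤end (ℤ.+≤+ (s≤s z≤n)) ⟩
      (z ℤ.- + suc a) ℤ.+ + suc a ≡⟨ minus-plus z (+ suc a) ⟩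
      z                           ∎
      where
      open ℤₚ.≤-Reasoning
      minus-plus : ∀ z b → (z ℤ.- b) ℤ.+ b ≡ z
      minus-plus = solve-∀

no-two-good-cuts : ∀ Xs Ys Zs → 0 < length Ys → 0 < length Zs → total (Xs ++ Ys ++ Zs) ≡ - + 1 →
                   StaysAbove (+ 0) (Ys ++ Zs ++ Xs) → ¬ StaysAbove (+ 0) ((Zs ++ Xs) ++ Ys)
no-two-good-cuts Xs Ys Zs 0<|Ys| 0<|Zs| total≡-1 aboveYZX aboveZXY = ℤₚ.<⇒≱ (ℤ.-<+ {0} {0}) (begin
  + 0                                                      ≤⟨ ℤₚ.+-mono-≤ afterYs afterZsXs ⟩
  (+ 0 ℤ.+ total Ys) ℤ.+ (+ 0 ℤ.+ total (Zs ++ Xs))        ≡⟨ cong (ℤ._+_ (+ 0 ℤ.+ total Ys) ∘′ (ℤ._+_ (+ 0))) (total-++ Zs Xs) ⟩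
  (+ 0 ℤ.+ total Ys) ℤ.+ (+ 0 ℤ.+ (total Zs ℤ.+ total Xs)) ≡⟨ regroup (total Xs) (total Ys) (total Zs) ⟩
  total Xs ℤ.+ (total Ys ℤ.+ total Zs)                     ≡⟨ cong (ℤ._+_ (total Xs)) (total-++ Ys Zs) ⟨
  total Xs ℤ.+ total (Ys ++ Zs)                            ≡⟨ total-++ Xs (Ys ++ Zs) ⟨
  total (Xs ++ Ys ++ Zs)                                   ≡⟨ total≡-1 ⟩
  - + 1                                                    ∎)
  where
  open ℤₚ.≤-Reasoning
  regroup : ∀ a b c → (+ 0 ℤ.+ b) ℤ.+ (+ 0 ℤ.+ (c ℤ.+ a)) ≡ a ℤ.+ (b ℤ.+ c)
  regroup = solve-∀
  afterYs : + 0 ℤ.≤ + 0 ℤ.+ total Ys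
  afterYs = StaysAbove-split (+ 0) Ys (Zs ++ Xs) (ℕₚ.<-≤-trans 0<|Zs| (Listₚ.length-++-≤ˡ Zs)) aboveYZX
  afterZsXs : + 0 ℤ.≤ + 0 ℤ.+ total (Zs ++ Xs)
  afterZsXs = StaysAbove-split (+ 0) (Zs ++ Xs) Ys 0<|Ys| aboveZXY

module _ {X : Set} where

  rotate : ℕ → List X → List X
  rotate i xs = drop i xs ++ take i xs

  rotate-++ : ∀ (xs ys : List X) → rotate (length xs) (xs ++ ys) ≡ ys ++ xs
  rotate-++ xs ys = cong₂ _++_ (drop-++ xs) (trans (take-++ xs) (Listₚ.++-identityʳ xs))
    where
    drop-++ : ∀ xs → drop (length xs) (xs ++ ys) ≡ ys
    drop-++ []       = refl
    drop-++ (x ∷ xs) = drop-++ xs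
    take-++ : ∀ xs → take (length xs) (xs ++ ys) ≡ xs ++ []
    take-++ []       = refl
    take-++ (x ∷ xs) = cong (x ∷_) (take-++ xs)

  rotate-rotate : ∀ j (xs : List X) → rotate (length xs ∸ j) (rotate j xs) ≡ xs
  rotate-rotate j xs = begin
    rotate (length xs ∸ j) (rotate j xs)      ≡⟨ cong (λ k → rotate k (rotate j xs)) (Listₚ.length-drop j xs) ⟨
    rotate (length (drop j xs)) (rotate j xs) ≡⟨ rotate-++ (drop j xs) (take j xs) ⟩
    take j xs ++ drop j xs                    ≡⟨ Listₚ.take++drop≡id j xs ⟩
    xs                                        ∎
    where open ≡-Reasoning

  rotate-rotate′ : ∀ j (xs : List X) → j ≤ length xs → rotate j (rotate (length xs ∸ j) xs) ≡ xs
  rotate-rotate′ j xs j≤|xs| =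
    subst (λ k → rotate k (rotate (length xs ∸ j) xs) ≡ xs) (ℕₚ.m∸[m∸n]≡n j≤|xs|) (rotate-rotate (length xs ∸ j) xs)

  length-rotate : ∀ j (xs : List X) → j ≤ length xs → length (rotate j xs) ≡ length xs
  length-rotate j xs j≤|xs| = begin
    length (drop j xs ++ take j xs)         ≡⟨ Listₚ.length-++ (drop j xs) ⟩
    length (drop j xs) + length (take j xs) ≡⟨ cong₂ _+_ (Listₚ.length-drop j xs) (trans (Listₚ.length-take j xs) (ℕₚ.m≤n⇒m⊓n≡m j≤|xs|)) ⟩
    (length xs ∸ j) + j                     ≡⟨ ℕₚ.m∸n+n≡m j≤|xs| ⟩
    length xs                               ∎
    where open ≡-Reasoning

map-rotate : ∀ {X Y : Set} (f : X → Y) j xs → map f (rotate j xs) ≡ rotate j (map f xs)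
map-rotate f j xs = trans (Listₚ.map-++ f (drop j xs) (take j xs))
                          (sym (cong₂ _++_ (Listₚ.drop-map {f = f} j xs) (Listₚ.take-map {f = f} j xs)))

total-rotate : ∀ j xs → total (rotate j xs) ≡ total xs
total-rotate j xs = begin
  total (drop j xs ++ take j xs)          ≡⟨ total-++ (drop j xs) (take j xs) ⟩
  total (drop j xs) ℤ.+ total (take j xs) ≡⟨ ℤₚ.+-comm (total (drop j xs)) _ ⟩
  total (take j xs) ℤ.+ total (drop j xs) ≡⟨ total-++ (take j xs) (drop j xs) ⟨
  total (take j xs ++ drop j xs)          ≡⟨ cong total (Listₚ.take++drop≡id j xs) ⟩
  total xs                                ∎
  where open ≡-Reasoning

take-+ : ∀ {X : Set} i d (xs : List X) → take (i + d) xs ≡ take i xs ++ take d (drop i xs)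
take-+ zero    d xs       = refl
take-+ (suc i) d []       = sym (Listₚ.take-[] d)
take-+ (suc i) d (x ∷ xs) = cong (x ∷_) (take-+ i d xs)

no-two-good-rotations : ∀ xs {i j} → i < j → j < length xs → total xs ≡ - + 1 →
                        StaysAbove (+ 0) (rotate i xs) → ¬ StaysAbove (+ 0) (rotate j xs)
no-two-good-rotations xs {i} {j} i<j j<|xs| total≡-1 aboveᵢ aboveⱼ =
  no-two-good-cuts Xs Ys Zs 0<|Ys| 0<|Zs| (trans (cong total Xs++Ys++Zs≡xs) total≡-1)
    (subst (StaysAbove (+ 0)) rotateᵢ aboveᵢ) (subst (StaysAbove (+ 0)) rotateⱼ aboveⱼ)
  where
  d = j ∸ i
  M = drop i xs
  Xs = take i xs
  Ys = take d M
  Zs = drop d M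
  Ys++Zs≡M : Ys ++ Zs ≡ M
  Ys++Zs≡M = Listₚ.take++drop≡id d M
  Xs++Ys++Zs≡xs : Xs ++ Ys ++ Zs ≡ xs
  Xs++Ys++Zs≡xs = trans (cong (Xs ++_) Ys++Zs≡M) (Listₚ.take++drop≡id i xs)
  rotateᵢ : rotate i xs ≡ Ys ++ Zs ++ Xs
  rotateᵢ = trans (cong (_++ Xs) (sym Ys++Zs≡M)) (Listₚ.++-assoc Ys Zs Xs)
  rotateⱼ : rotate j xs ≡ (Zs ++ Xs) ++ Ys
  rotateⱼ = begin
    drop j xs ++ take j xs             ≡⟨ cong (λ k → drop k xs ++ take k xs) (ℕₚ.m+[n∸m]≡n (ℕₚ.<⇒≤ i<j)) ⟨
    drop (i + d) xs ++ take (i + d) xs ≡⟨ cong₂ _++_ (Listₚ.drop-drop i d xs) (sym (take-+ i d xs)) ⟨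
    Zs ++ Xs ++ Ys                     ≡⟨ Listₚ.++-assoc Zs Xs Ys ⟨
    (Zs ++ Xs) ++ Ys                   ∎
    where open ≡-Reasoning
  d<|M| : d < length M
  d<|M| = subst (d <_) (sym (Listₚ.length-drop i xs)) (ℕₚ.∸-monoˡ-< j<|xs| (ℕₚ.<⇒≤ i<j))
  0<|Ys| : 0 < length Ys
  0<|Ys| = subst (0 <_) (sym (trans (Listₚ.length-take d M) (ℕₚ.m≤n⇒m⊓n≡m (ℕₚ.<⇒≤ d<|M|)))) (ℕₚ.m<n⇒0<n∸m i<j)
  0<|Zs| : 0 < length Zs
  0<|Zs| = subst (0 <_) (sym (Listₚ.length-drop d M)) (ℕₚ.m<n⇒0<n∸m d<|M|)

good-rotation-unique : ∀ xs {i j} → i < length xs → j < length xs → total xs ≡ - + 1 →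
                       StaysAbove (+ 0) (rotate i xs) → StaysAbove (+ 0) (rotate j xs) → i ≡ j
good-rotation-unique xs {i} {j} i<|xs| j<|xs| total≡-1 aboveᵢ aboveⱼ with ℕₚ.<-cmp i j
... | tri< i<j _ _ = ⊥-elim (no-two-good-rotations xs i<j j<|xs| total≡-1 aboveᵢ aboveⱼ)
... | tri≈ _ i≡j _ = i≡j
... | tri> _ _ j<i = ⊥-elim (no-two-good-rotations xs j<i i<|xs| total≡-1 aboveⱼ aboveᵢ)

first-argmin : (f : ℕ → ℤ) → ∀ n →
  ∃ λ j → j ≤ n × (∀ t → t < j → f j ℤ.< f t) × (∀ t → t ≤ n → f j ℤ.≤ f t)
first-argmin f zero = 0 , z≤n , (λ _ ()) , λ { zero _ → ℤₚ.≤-refl }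
first-argmin f (suc n) with first-argmin f n
... | j , j≤n , before , minimal with f (suc n) ℤₚ.<? f j
...   | yes fn<fj = suc n , ℕₚ.≤-refl , (λ t t≤n → below t (ℕₚ.≤-pred t≤n)) , minimal′
  where
  below : ∀ t → t ≤ n → f (suc n) ℤ.< f t
  below t t≤n = ℤₚ.<-≤-trans fn<fj (minimal t t≤n)
  minimal′ : ∀ t → t ≤ suc n → f (suc n) ℤ.≤ f t
  minimal′ t t≤sn with ℕₚ.m≤n⇒m<n∨m≡n t≤sn
  ... | inj₁ t<sn = ℤₚ.<⇒≤ (below t (ℕₚ.≤-pred t<sn))
  ... | inj₂ refl = ℤₚ.≤-refl
...   | no fn≮fj = j , ℕₚ.m≤n⇒m≤1+n j≤n , before , minimal′
  where
  minimal′ : ∀ t → t ≤ suc n → f j ℤ.≤ f t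
  minimal′ t t≤sn with ℕₚ.m≤n⇒m<n∨m≡n t≤sn
  ... | inj₁ t<sn = minimal t (ℕₚ.≤-pred t<sn)
  ... | inj₂ refl = ℤₚ.≮⇒≥ fn≮fj

<-length-drop : ∀ {X : Set} j (xs : List X) {t} → t < length (drop j xs) → j + t < length xs
<-length-drop zero    xs       t<|drop| = t<|drop|
<-length-drop (suc j) []       ()
<-length-drop (suc j) (x ∷ xs) t<|drop| = s≤s (<-length-drop j xs t<|drop|)

prefixSum : List ℤ → ℕ → ℤ
prefixSum xs t = total (take t xs)

StaysAbove-drop : ∀ xs j → (∀ t → j + t < length xs → prefixSum xs j ℤ.≤ prefixSum xs (j + t)) →
                  StaysAbove (+ 0) (drop j xs)
StaysAbove-drop xs j minimal = StaysAbove-prefixes (+ 0) (drop j xs) λ t t<|drop| →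
  subst (+ 0 ℤ.≤_) (trans (cong (ℤ._- prefixSum xs j) (split t)) (cancel (prefixSum xs j) _))
        (ℤₚ.i≤j⇒0≤j-i (minimal t (<-length-drop j xs t<|drop|)))
  where
  split : ∀ t → prefixSum xs (j + t) ≡ prefixSum xs j ℤ.+ total (take t (drop j xs))
  split t = trans (cong total (take-+ j t xs)) (total-++ (take j xs) (take t (drop j xs)))
  cancel : ∀ a b → a ℤ.+ b ℤ.- a ≡ + 0 ℤ.+ b
  cancel = solve-∀

StaysAbove-take : ∀ xs j → total xs ≡ - + 1 → (∀ t → t < j → prefixSum xs j ℤ.< prefixSum xs t) →
                  StaysAbove (+ 0 ℤ.+ total (drop j xs)) (take j xs)
StaysAbove-take xs j total≡-1 strictly-minimal = StaysAbove-prefixes _ (take j xs) λ t t<|take| →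
  let t<j = ℕₚ.<-≤-trans t<|take| (subst (_≤ j) (sym (Listₚ.length-take j xs)) (ℕₚ.m⊓n≤m j (length xs)))
  in subst (+ 0 ℤ.≤_) (sym (prefix-height t<j)) (ℤₚ.i≤j⇒0≤j-i (ℤₚ.i<j⇒suc[i]≤j (strictly-minimal t t<j)))
  where
  fⱼ = prefixSum xs j
  fⱼ+total-drop≡-1 : fⱼ ℤ.+ total (drop j xs) ≡ - + 1
  fⱼ+total-drop≡-1 = trans (sym (total-++ (take j xs) (drop j xs))) (trans (cong total (Listₚ.take++drop≡id j xs)) total≡-1)
  regroup : ∀ d a c → (+ 0 ℤ.+ d) ℤ.+ c ≡ c ℤ.- (+ 1 ℤ.+ a) ℤ.+ (a ℤ.+ d ℤ.+ + 1)
  regroup = solve-∀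
  prefix-height : ∀ {t} → t < j → (+ 0 ℤ.+ total (drop j xs)) ℤ.+ total (take t (take j xs)) ≡ prefixSum xs t ℤ.- ℤ.suc fⱼ
  prefix-height {t} t<j = begin
    (+ 0 ℤ.+ total (drop j xs)) ℤ.+ total (take t (take j xs))
      ≡⟨ cong (ℤ._+_ (+ 0 ℤ.+ total (drop j xs)) ∘′ total) take-take ⟩
    (+ 0 ℤ.+ total (drop j xs)) ℤ.+ fₜ
      ≡⟨ regroup (total (drop j xs)) fⱼ fₜ ⟩
    fₜ ℤ.- ℤ.suc fⱼ ℤ.+ (fⱼ ℤ.+ total (drop j xs) ℤ.+ + 1)
      ≡⟨ cong (λ z → fₜ ℤ.- ℤ.suc fⱼ ℤ.+ (z ℤ.+ + 1)) fⱼ+total-drop≡-1 ⟩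
    fₜ ℤ.- ℤ.suc fⱼ ℤ.+ + 0
      ≡⟨ ℤₚ.+-identityʳ _ ⟩
    fₜ ℤ.- ℤ.suc fⱼ ∎
    where
    open ≡-Reasoning
    fₜ = prefixSum xs t
    take-take : take t (take j xs) ≡ take t xs
    take-take = trans (Listₚ.take-take t j xs) (cong (λ k → take k xs) (ℕₚ.m≤n⇒m⊓n≡m (ℕₚ.<⇒≤ t<j)))

-- Rotate to just after the first minimum of the prefix sums.
good-rotation-exists : ∀ xs → 0 < length xs → total xs ≡ - + 1 →
                       ∃ λ j → j < length xs × StaysAbove (+ 0) (rotate j xs)
good-rotation-exists xs@(_ ∷ xs′) _ total≡-1 =
  let j , j≤|xs′| , strictly-minimal , minimal = first-argmin (prefixSum xs) (length xs′)
  in j , s≤s j≤|xs′| ,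
     StaysAbove-++⁺ (+ 0) (drop j xs) (take j xs)
       (StaysAbove-drop xs j (λ t j+t<|xs| → minimal (j + t) (ℕₚ.≤-pred j+t<|xs|)))
       (StaysAbove-take xs j total≡-1 strictly-minimal)

module CycleLemma {X : Set} (w : X → ℤ) where

  Balanced : ℕ → List X → Set
  Balanced n xs = length xs ≡ n × total (map w xs) ≡ - + 1

  Good : List X → Set
  Good xs = StaysAbove (+ 0) (map w xs)

  Balanced-irrelevant : ∀ n xs → Irrelevant (Balanced n xs)
  Balanced-irrelevant n xs = ≡×≡-irrelevant

  Balanced∧Good-irrelevant : ∀ n xs → Irrelevant (Balanced n xs × Good xs)
  Balanced∧Good-irrelevant n xs = ×-irrelevant (Balanced-irrelevant n xs) (StaysAbove-irrelevant (+ 0) (map w xs))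

  Balanced-rotate : ∀ {n} j xs → j ≤ n → Balanced n xs → Balanced n (rotate j xs)
  Balanced-rotate j xs j≤n (refl , total≡-1) =
    length-rotate j xs j≤n , trans (cong total (map-rotate w j xs)) (trans (total-rotate j (map w xs)) total≡-1)

  |map|≡n : ∀ {n} xs → Balanced n xs → length (map w xs) ≡ n
  |map|≡n xs (|xs|≡n , _) = trans (Listₚ.length-map w xs) |xs|≡n

  GoodRotation : List X → Set
  GoodRotation xs = ∃ λ j → j < length (map w xs) × StaysAbove (+ 0) (rotate j (map w xs))

  module _ (n : ℕ) (0<n : 0 < n) where

    good-rotation : ∀ xs → Balanced n xs → GoodRotation xs
    good-rotation xs b@(_ , total≡-1) = good-rotation-exists (map w xs) (subst (0 <_) (sym (|map|≡n xs b)) 0<n) total≡-1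

    rotateToGood : ∀ xs → Balanced n xs → GoodRotation xs → Fin n × Σ (List X) (λ ys → Balanced n ys × Good ys)
    rotateToGood xs b (j , j<|xs| , above) =
      let j<n = subst (j <_) (|map|≡n xs b) j<|xs|
      in fromℕ< j<n , rotate j xs , Balanced-rotate j xs (ℕₚ.<⇒≤ j<n) b , subst (StaysAbove (+ 0)) (sym (map-rotate w j xs)) above

    rotateBack : Fin n × Σ (List X) (λ ys → Balanced n ys × Good ys) → Σ (List X) (Balanced n)
    rotateBack (i , ys , b , _) = rotate (n ∸ toℕ i) ys , Balanced-rotate (n ∸ toℕ i) ys (ℕₚ.m∸n≤m n (toℕ i)) b

    rotateBack-rotateToGood : ∀ xs b → rotateBack (rotateToGood xs b (good-rotation xs b)) ≡ (xs , b)
    rotateBack-rotateToGood xs b@(refl , _) with good-rotation xs b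
    ... | j , j<|xs| , _ = Σ-≡-irrelevant (Balanced-irrelevant n) (begin
      rotate (length xs ∸ toℕ (fromℕ< j<n)) (rotate j xs) ≡⟨ cong (λ k → rotate (length xs ∸ k) (rotate j xs)) (Finₚ.toℕ-fromℕ< j<n) ⟩
      rotate (length xs ∸ j) (rotate j xs)                ≡⟨ rotate-rotate j xs ⟩
      xs                                                  ∎)
      where
      open ≡-Reasoning
      j<n = subst (j <_) (|map|≡n xs b) j<|xs|

    rotateToGood-rotateBack : ∀ i ys b g b′ r → rotateToGood (rotate (n ∸ toℕ i) ys) b′ r ≡ (i , ys , b , g)
    rotateToGood-rotateBack i ys b@(refl , _) g b′ (j , j<|xs| , above) =
      cong₂ _,_ (Finₚ.toℕ-injective (trans (Finₚ.toℕ-fromℕ< _) j≡i))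
                (Σ-≡-irrelevant (Balanced∧Good-irrelevant n) (trans (cong (λ k → rotate k xs) j≡i) rotate-i-xs))
      where
      xs = rotate (n ∸ toℕ i) ys
      rotate-i-xs : rotate (toℕ i) xs ≡ ys
      rotate-i-xs = rotate-rotate′ (toℕ i) ys (ℕₚ.<⇒≤ (Finₚ.toℕ<n i))
      aboveᵢ : StaysAbove (+ 0) (rotate (toℕ i) (map w xs))
      aboveᵢ = subst (StaysAbove (+ 0)) (trans (cong (map w) (sym rotate-i-xs)) (map-rotate w (toℕ i) xs)) g
      j≡i : j ≡ toℕ i
      j≡i = good-rotation-unique (map w xs) j<|xs| (subst (toℕ i <_) (sym (|map|≡n xs b′)) (Finₚ.toℕ<n i))
              (proj₂ b′) above aboveᵢ

    cycle-lemma : (Fin n × Σ (List X) (λ xs → Balanced n xs × Good xs)) ↔ Σ (List X) (Balanced n)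
    cycle-lemma = mk↔ₛ′ rotateBack (λ (xs , b) → rotateToGood xs b (good-rotation xs b))
      (λ (xs , b) → rotateBack-rotateToGood xs b)
      (λ (i , ys , b , g) → rotateToGood-rotateBack i ys b g _ _)

-- Cutting a path into blocks

module Blocks (N K : ℕ) where
  open Steps N K

  Horizontal : Set
  Horizontal = Fin (suc N) ⊎ Fin K

  horizontal : Horizontal → Step N K
  horizontal (inj₁ i) = U i
  horizontal (inj₂ j) = D j

  stepHeight : Step N K → ℤ
  stepHeight = proj₂ ∘ vec

  -- a horizontal step followed by a run of vertical steps
  Block : Set
  Block = Horizontal × ℕ

  blockHeight : Block → ℤ
  blockHeight (s , a) = stepHeight (horizontal s) ℤ.- + a

  fromBlocks : List Block → List (Step N K)
  fromBlocks []            = []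
  fromBlocks ((s , a) ∷ bs) = horizontal s ∷ replicate a V ++ fromBlocks bs

  unparse : ℕ × List Block → List (Step N K)
  unparse (a , bs) = replicate a V ++ fromBlocks bs

  parse : List (Step N K) → ℕ × List Block
  parse []      = 0 , []
  parse (V ∷ p) = let a , bs = parse p in suc a , bs
  parse (U i ∷ p) = let a , bs = parse p in 0 , (inj₁ i , a) ∷ bs
  parse (D j ∷ p) = let a , bs = parse p in 0 , (inj₂ j , a) ∷ bs

  unparse-parse : ∀ p → unparse (parse p) ≡ p
  unparse-parse []        = refl
  unparse-parse (V ∷ p)   = cong (V ∷_) (unparse-parse p)
  unparse-parse (U i ∷ p) = cong (U i ∷_) (unparse-parse p)
  unparse-parse (D j ∷ p) = cong (D j ∷_) (unparse-parse p)

  parse-unparse : ∀ a bs → parse (unparse (a , bs)) ≡ (a , bs)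
  parse-unparse (suc a) bs = cong (λ (a , bs) → suc a , bs) (parse-unparse a bs)
  parse-unparse zero [] = refl
  parse-unparse zero ((inj₁ i , a) ∷ bs) = cong (λ (a , bs) → 0 , (inj₁ i , a) ∷ bs) (parse-unparse a bs)
  parse-unparse zero ((inj₂ j , a) ∷ bs) = cong (λ (a , bs) → 0 , (inj₂ j , a) ∷ bs) (parse-unparse a bs)

  unparse↔ : (ℕ × List Block) ↔ List (Step N K)
  unparse↔ = mk↔ₛ′ unparse parse unparse-parse (λ (a , bs) → parse-unparse a bs)

  height-∷ : ∀ s p → height (s ∷ p) ≡ stepHeight s ℤ.+ height p
  height-∷ s p = sym (cong proj₂ (vec-⊕ s p))

  width-replicate-V : ∀ a p → width (replicate a V ++ p) ≡ width p
  width-replicate-V zero    p = refl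
  width-replicate-V (suc a) p = width-replicate-V a p

  height-replicate-V : ∀ a p → height (replicate a V ++ p) ≡ - + a ℤ.+ height p
  height-replicate-V zero    p = sym (ℤₚ.+-identityˡ (height p))
  height-replicate-V (suc a) p = begin
    height (V ∷ replicate a V ++ p)       ≡⟨ height-∷ V (replicate a V ++ p) ⟩
    - + 1 ℤ.+ height (replicate a V ++ p) ≡⟨ cong (ℤ._+_ (- + 1)) (height-replicate-V a p) ⟩
    - + 1 ℤ.+ (- + a ℤ.+ height p)        ≡⟨ regroup (+ a) (height p) ⟩
    - (+ 1 ℤ.+ + a) ℤ.+ height p          ≡⟨ cong (λ z → - z ℤ.+ height p) (ℤₚ.pos-+ 1 a) ⟨
    - + suc a ℤ.+ height p                ∎
    where
    open ≡-Reasoning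
    regroup : ∀ a h → - + 1 ℤ.+ (- a ℤ.+ h) ≡ - (+ 1 ℤ.+ a) ℤ.+ h
    regroup = solve-∀

  width-fromBlocks : ∀ bs → width (fromBlocks bs) ≡ length bs
  width-fromBlocks []                  = refl
  width-fromBlocks ((inj₁ _ , a) ∷ bs) = cong suc (trans (width-replicate-V a (fromBlocks bs)) (width-fromBlocks bs))
  width-fromBlocks ((inj₂ _ , a) ∷ bs) = cong suc (trans (width-replicate-V a (fromBlocks bs)) (width-fromBlocks bs))

  height-fromBlocks : ∀ bs → height (fromBlocks bs) ≡ total (map blockHeight bs)
  height-fromBlocks []             = height-[] (+ N)
    where
    height-[] : ∀ n → n ℤ.* + 0 ℤ.- + 0 ≡ + 0
    height-[] = solve-∀
  height-fromBlocks ((s , a) ∷ bs) = begin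
    height (horizontal s ∷ replicate a V ++ fromBlocks bs)
      ≡⟨ height-∷ (horizontal s) (replicate a V ++ fromBlocks bs) ⟩
    stepHeight (horizontal s) ℤ.+ height (replicate a V ++ fromBlocks bs)
      ≡⟨ cong (ℤ._+_ (stepHeight (horizontal s))) (height-replicate-V a (fromBlocks bs)) ⟩
    stepHeight (horizontal s) ℤ.+ (- + a ℤ.+ height (fromBlocks bs))
      ≡⟨ sym (ℤₚ.+-assoc (stepHeight (horizontal s)) (- + a) (height (fromBlocks bs))) ⟩
    blockHeight (s , a) ℤ.+ height (fromBlocks bs)
      ≡⟨ cong (ℤ._+_ (blockHeight (s , a))) (height-fromBlocks bs) ⟩
    total (map blockHeight ((s , a) ∷ bs))
      ∎
    where open ≡-Reasoning

  open CycleLemma blockHeight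

  fromBlocks-endpoint⇔ : ∀ bs n m →
    (length bs ≡ n × total (map blockHeight bs) ≡ - + m) ⇔ (width (fromBlocks bs) ≡ n × totalCost (fromBlocks bs) ≡ N * n + m)
  fromBlocks-endpoint⇔ bs n m = width-height⇔ (fromBlocks bs) n m ⇔-∘
    mk⇔ (λ (l , t) → trans (width-fromBlocks bs) l , trans (height-fromBlocks bs) t)
        (λ (w , h) → trans (sym (width-fromBlocks bs)) w , trans (sym (height-fromBlocks bs)) h)

  width-horizontal-∷ : ∀ s p → width (horizontal s ∷ p) ≡ suc (width p)
  width-horizontal-∷ (inj₁ _) p = refl
  width-horizontal-∷ (inj₂ _) p = refl

  Balanced-uncons : ∀ n → Σ (List Block) (Balanced (suc n)) ↔
    Σ Horizontal (λ s → Σ (ℕ × List Block) λ (a , bs) → Balanced (suc n) ((s , a) ∷ bs))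
  Balanced-uncons n = mk↔ₛ′
    (λ { ((s , a) ∷ bs , b) → s , (a , bs) , b })
    (λ { (s , (a , bs) , b) → (s , a) ∷ bs , b })
    (λ _ → refl)
    (λ { ((s , a) ∷ bs , b) → refl })

  balanced-count : ∀ n → Fin (ledCount n (N * suc n + 1)) ↔ Σ (List Block) (Balanced (suc n))
  balanced-count n = begin
    Fin (ledCount n R)
      ↔⟨ ledCount-tails n R ⟩
    Σ (Fin L) (λ c → Tails (suc n) (toℕ c) R)
      ↔⟨ Σ-horizontal (λ c → Tails (suc n) c R) ⟨
    (Σ (Fin (suc N)) (λ i → Tails (suc n) (cost (U i)) R) ⊎ Σ (Fin K) (λ j → Tails (suc n) (cost (D j)) R))
      ↔⟨ Σ-distribʳ-⊎ ⟨
    Σ Horizontal (λ s → Tails (suc n) (cost (horizontal s)) R)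
      ↔⟨ Σ-↔ ↔-refl (λ {s} → Σ-↔ unparse↔ (λ {(a , bs)} → balanced⇔tail s a bs)) ⟨
    Σ Horizontal (λ s → Σ (ℕ × List Block) λ (a , bs) → Balanced (suc n) ((s , a) ∷ bs))
      ↔⟨ Balanced-uncons n ⟨
    Σ (List Block) (Balanced (suc n)) ∎
    where
    open EquationalReasoning
    R = N * suc n + 1
    balanced⇔tail : ∀ s a bs → Balanced (suc n) ((s , a) ∷ bs) ↔
      (suc (width (unparse (a , bs))) ≡ suc n × cost (horizontal s) + totalCost (unparse (a , bs)) ≡ R)
    balanced⇔tail s a bs = irrelevant-↔ (Balanced-irrelevant (suc n) ((s , a) ∷ bs)) ≡×≡-irrelevant
      (λ b → let w , c = Equivalence.to (fromBlocks-endpoint⇔ ((s , a) ∷ bs) (suc n) 1) b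
             in trans (sym (width-horizontal-∷ s (unparse (a , bs)))) w , c)
      (λ (w , c) → Equivalence.from (fromBlocks-endpoint⇔ ((s , a) ∷ bs) (suc n) 1)
                     (trans (width-horizontal-∷ s (unparse (a , bs))) w , c))

  good-balanced-count : ∀ n → ∃ λ c → (Fin c ↔ Σ (List Block) (λ bs → Balanced (suc n) bs × Good bs)) ×
                                        suc n * c ≡ ledCount n (N * suc n + 1)
  good-balanced-count n = c , goodBalanced , ↔⇒≡ (begin
    Fin (suc n * c)                                                       ↔⟨ Finₚ.*↔× ⟩
    (Fin (suc n) × Fin c)                                                 ↔⟨ ↔-refl ×-↔ goodBalanced ⟩
    (Fin (suc n) × Σ (List Block) (λ bs → Balanced (suc n) bs × Good bs)) ↔⟨ cycle-lemma (suc n) (s≤s z≤n) ⟩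
    Σ (List Block) (Balanced (suc n))                                     ↔⟨ balanced-count n ⟨
    Fin (ledCount n (N * suc n + 1))                                      ∎)
    where
    open EquationalReasoning
    goodSubset = finite-subset (balanced-count n) (λ (bs , _) → StaysAbove? (+ 0) (map blockHeight bs))
                   (λ (bs , _) → StaysAbove-irrelevant (+ 0) (map blockHeight bs))
    c = proj₁ goodSubset
    goodBalanced : Fin c ↔ Σ (List Block) (λ bs → Balanced (suc n) bs × Good bs)
    goodBalanced = ↔-trans (proj₂ goodSubset) Σ-assoc

  AboveExceptLast-irrelevant : ∀ q (p : List (Step N K)) → Irrelevant (AboveExceptLast q p)
  AboveExceptLast-irrelevant q       []      tt tt = refl
  AboveExceptLast-irrelevant (x , y) (s ∷ p) = ×-irrelevant ℤₚ.≤-irrelevant (AboveExceptLast-irrelevant _ p)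

  AboveExceptLast⇔StaysAbove : ∀ x y p → AboveExceptLast (x , y) p ⇔ StaysAbove y (map stepHeight p)
  AboveExceptLast⇔StaysAbove x y p = mk⇔ (to x y p) (from x y p)
    where
    to : ∀ x y p → AboveExceptLast (x , y) p → StaysAbove y (map stepHeight p)
    to x y []      _               = tt
    to x y (s ∷ p) (0≤y , above) = 0≤y , to _ _ p above
    from : ∀ x y p → StaysAbove y (map stepHeight p) → AboveExceptLast (x , y) p
    from x y []      _               = tt
    from x y (s ∷ p) (0≤y , above) = 0≤y , from _ _ p above

  heights-replicate-V : ∀ a p → map stepHeight (replicate a V ++ p) ≡ replicate a (- + 1) ++ map stepHeight p
  heights-replicate-V zero    p = refl
  heights-replicate-V (suc a) p = cong (- + 1 ∷_) (heights-replicate-V a p)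

  fromBlocks-StaysAbove⇔ : ∀ y bs → y ℤ.+ total (map blockHeight bs) ≡ - + 1 →
    StaysAbove y (map stepHeight (fromBlocks bs)) ⇔ StaysAbove y (map blockHeight bs)
  fromBlocks-StaysAbove⇔ y []             _      = mk⇔ (λ _ → tt) (λ _ → tt)
  fromBlocks-StaysAbove⇔ y ((s , a) ∷ bs) ends-1 = mk⇔
    (λ (0≤y , above) → 0≤y , Equivalence.to IH (subst (λ z → StaysAbove z rest) y′≡
      (StaysAbove-descent⁻ (y ℤ.+ h) a (subst (StaysAbove (y ℤ.+ h)) (heights-replicate-V a (fromBlocks bs)) above))))
    (λ (0≤y , above) → 0≤y , subst (StaysAbove (y ℤ.+ h)) (sym (heights-replicate-V a (fromBlocks bs)))
      (StaysAbove-descent⁺ (y ℤ.+ h) a (subst (- + 1 ℤ.≤_) (sym y′≡) (StaysAbove-≥-1 y′ _ above ends-1′))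
        (subst (λ z → StaysAbove z rest) (sym y′≡) (Equivalence.from IH above))))
    where
    h = stepHeight (horizontal s)
    y′ = y ℤ.+ blockHeight (s , a)
    rest = map stepHeight (fromBlocks bs)
    y′≡ : (y ℤ.+ h) ℤ.- + a ≡ y′
    y′≡ = ℤₚ.+-assoc y h (- + a)
    ends-1′ : y′ ℤ.+ total (map blockHeight bs) ≡ - + 1
    ends-1′ = trans (ℤₚ.+-assoc y (blockHeight (s , a)) _) ends-1
    IH = fromBlocks-StaysAbove⇔ y′ bs ends-1′

  PathCond : ℕ → List (Step N K) → Set
  PathCond n p = (endFrom origin p ≡ (+ n , - + 1)) × AboveExceptLast origin p

  -- A path in P(1, n) cannot start with V: its second point would lie below the axis without being its last.
  no-leading-V : ∀ n → 0 < n → ∀ a bs → ¬ PathCond n (unparse (suc a , bs))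
  no-leading-V n 0<n zero    []      (e , _)          = ℕₚ.<⇒≢ 0<n (ℤₚ.+-injective (cong proj₁ e))
  no-leading-V n 0<n zero    (_ ∷ _) (_ , _ , () , _)
  no-leading-V n 0<n (suc a) bs      (_ , _ , () , _)

  fromBlocks-endFrom⇔ : ∀ n bs → endFrom origin (fromBlocks bs) ≡ (+ n , - + 1) ⇔ Balanced n bs
  fromBlocks-endFrom⇔ n bs = ⇔-sym (fromBlocks-endpoint⇔ bs n 1) ⇔-∘ endFrom≡⇔ (fromBlocks bs) n 1

  P↔GoodBalanced : ∀ n → 0 < n → P N K 1 n ↔ Σ (List Block) (λ bs → Balanced n bs × Good bs)
  P↔GoodBalanced n 0<n = begin
    Σ (List (Step N K)) (PathCond n)                ↔⟨ Σ-↔ unparse↔ ↔-refl ⟨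
    Σ (ℕ × List Block) (PathCond n ∘ unparse)       ↔⟨ Σ-ℕ×-zero (no-leading-V n 0<n) ⟩
    Σ (List Block) (PathCond n ∘ fromBlocks)        ↔⟨ Σ-↔ ↔-refl (λ {bs} → fibre bs) ⟩
    Σ (List Block) (λ bs → Balanced n bs × Good bs) ∎
    where
    open EquationalReasoning
    fibre : ∀ bs → PathCond n (fromBlocks bs) ↔ (Balanced n bs × Good bs)
    fibre bs = irrelevant-↔ (×-irrelevant ≡-irrelevant (AboveExceptLast-irrelevant origin (fromBlocks bs)))
      (Balanced∧Good-irrelevant n bs)
      (λ (e , above) → let b = Equivalence.to (fromBlocks-endFrom⇔ n bs) e in
        b , Equivalence.to (fromBlocks-StaysAbove⇔ (+ 0) bs (ends-1 b))
              (Equivalence.to (AboveExceptLast⇔StaysAbove (+ 0) (+ 0) (fromBlocks bs)) above))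
      (λ (b , good) → Equivalence.from (fromBlocks-endFrom⇔ n bs) b ,
        Equivalence.from (AboveExceptLast⇔StaysAbove (+ 0) (+ 0) (fromBlocks bs))
          (Equivalence.from (fromBlocks-StaysAbove⇔ (+ 0) bs (ends-1 b)) good))
      where
      ends-1 : Balanced n bs → + 0 ℤ.+ total (map blockHeight bs) ≡ - + 1
      ends-1 (_ , total≡-1) = trans (ℤₚ.+-identityˡ _) total≡-1

sumTo-extend : ∀ u d (t : ℕ → ℤ) → (∀ k → u < k → t k ≡ + 0) → sumTo (u + d) t ≡ sumTo u t
sumTo-extend u zero    t _ = cong (λ v → sumTo v t) (ℕₚ.+-identityʳ u)
sumTo-extend u (suc d) t vanish rewrite ℕₚ.+-suc u d =
  trans (cong₂ ℤ._+_ (sumTo-extend u d t vanish) (vanish (suc (u + d)) (s≤s (ℕₚ.m≤m+n u d)))) (ℤₚ.+-identityʳ _)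

sumTo-vanishing : ∀ a b (t : ℕ → ℤ) → (∀ k → a < k → t k ≡ + 0) → (∀ k → b < k → t k ≡ + 0) → sumTo a t ≡ sumTo b t
sumTo-vanishing a b t vanishᵃ vanishᵇ with ℕₚ.≤-total a b
... | inj₁ a≤b = trans (sym (sumTo-extend a (b ∸ a) t vanishᵃ)) (cong (λ u → sumTo u t) (ℕₚ.m+[n∸m]≡n a≤b))
... | inj₂ b≤a = trans (cong (λ u → sumTo u t) (sym (ℕₚ.m+[n∸m]≡n b≤a))) (sumTo-extend b (a ∸ b) t vanishᵇ)

/<⇒< : ∀ r L k → r / suc L < k → r < k * suc L
/<⇒< r L k r/L<k with k * suc L ℕₚ.≤? r
... | no  k*L≰r = ℕₚ.≰⇒> k*L≰r
... | yes k*L≤r = ⊥-elim (ℕₚ.<⇒≱ r/L<k (subst (_≤ r / suc L) (m*n/n≡m k (suc L)) (/-monoˡ-≤ (suc L) k*L≤r)))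

+∸<ˡ : ∀ r i j → r < j → 1 ≤ i → r + i ∸ j < i
+∸<ˡ zero    (suc i) (suc j) _       _   = s≤s (ℕₚ.m∸n≤m i j)
+∸<ˡ (suc r) i       (suc j) (s≤s r<j) 1≤i = +∸<ˡ r i j r<j 1≤i

-- Only the terms with kL ≤ r survive.
altSum-truncate : ∀ n i r L → 1 ≤ i →
  altSum n n (λ k → + ((r + i ∸ k * suc L) C i)) ≡ sumTo (r / suc L) (λ k → sgn k *ℤ + ((n C k) * ((r + i ∸ k * suc L) C i)))
altSum-truncate n i r L 1≤i = trans
  (sumTo-cong n (λ k → cong (sgn k *ℤ_) (sym (ℤₚ.pos-* (n C k) _))))
  (sumTo-vanishing n (r / suc L) term vanish-above-n vanish-above-r/L)
  where
  term : ℕ → ℤ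
  term k = sgn k *ℤ + ((n C k) * ((r + i ∸ k * suc L) C i))
  vanish-above-n : ∀ k → n < k → term k ≡ + 0
  vanish-above-n k n<k rewrite k>n⇒nCk≡0 n<k = ℤₚ.*-zeroʳ (sgn k)
  vanish-above-r/L : ∀ k → r / suc L < k → term k ≡ + 0
  vanish-above-r/L k r/L<k rewrite k>n⇒nCk≡0 (+∸<ˡ r i (k * suc L) (/<⇒< r L k r/L<k) 1≤i) | ℕₚ.*-zeroʳ (n C k) =
    ℤₚ.*-zeroʳ (sgn k)

module _ (N K : ℕ) where
  open Steps N K
  open Blocks N K

  F-count : ∀ m n → 1 ≤ n →
    ∃ λ c → (Fin c ↔ F N K m n) ×
      (+ c ≡ sumTo ((N * n + m) / suc (N + K)) (λ k →
          sgn k *ℤ + ((n C k) * ((n * (N + 2) + m ∸ k * suc (N + K)) C (2 * n)))))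
  F-count m n 1≤n = wordCount n r , ↔-trans (wordCount-words n r) (↔-sym (F↔Words m n)) , (begin
    + wordCount n r
      ≡⟨ wordCount-formula n r 1≤n ⟩
    altSum n n (λ k → + ((r + 2 * n ∸ k * L) C (2 * n)))
      ≡⟨ altSum-truncate n (2 * n) r (N + K) (ℕₚ.≤-trans 1≤n (ℕₚ.m≤m+n n _)) ⟩
    sumTo (r / L) (λ k → sgn k *ℤ + ((n C k) * ((r + 2 * n ∸ k * L) C (2 * n))))
      ≡⟨ cong (λ x → sumTo (r / L) (λ k → sgn k *ℤ + ((n C k) * ((x ∸ k * L) C (2 * n))))) r+2n≡ ⟩
    sumTo (r / L) (λ k → sgn k *ℤ + ((n C k) * ((n * (N + 2) + m ∸ k * L) C (2 * n)))) ∎)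
    where
    open ≡-Reasoning
    r = N * n + m
    r+2n≡ : r + 2 * n ≡ n * (N + 2) + m
    r+2n≡ = solve 3 (λ N n m → N :* n :+ m :+ con 2 :* n := n :* (N :+ con 2) :+ m) refl N n m

  P-count : ∀ n → 1 ≤ n →
    ∃ λ c → (Fin c ↔ P N K 1 n) ×
      (+ (n * c) ≡ sumTo ((N * n + 1) / suc (N + K)) (λ k →
          sgn k *ℤ + ((n C k) * ((n * (N + 2) ∸ k * suc (N + K)) C (2 * n ∸ 1)))))
  P-count (suc n) _ =
    let c , goodBalanced , n*c≡ledCount = good-balanced-count n in
    c , ↔-trans goodBalanced (↔-sym (P↔GoodBalanced (suc n) (s≤s z≤n))) , (begin
    + (suc n * c)
      ≡⟨ cong +_ n*c≡ledCount ⟩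
    + ledCount n R
      ≡⟨ ledCount-formula n R ⟩
    altSum (suc n) (suc n) (λ k → + ((R + i ∸ k * L) C i))
      ≡⟨ altSum-truncate (suc n) i R (N + K) (s≤s z≤n) ⟩
    sumTo (R / L) (λ k → sgn k *ℤ + ((suc n C k) * ((R + i ∸ k * L) C i)))
      ≡⟨ cong₂ (λ x j → sumTo (R / L) (λ k → sgn k *ℤ + ((suc n C k) * ((x ∸ k * L) C j)))) R+i≡ i≡ ⟩
    sumTo (R / L) (λ k → sgn k *ℤ + ((suc n C k) * ((suc n * (N + 2) ∸ k * L) C (2 * suc n ∸ 1)))) ∎)
    where
    open ≡-Reasoning
    R = N * suc n + 1
    i = suc (2 * n)
    R+i≡ : R + i ≡ suc n * (N + 2)
    R+i≡ = solve 2 (λ N n → N :* (con 1 :+ n) :+ con 1 :+ (con 1 :+ con 2 :* n) := (con 1 :+ n) :* (N :+ con 2)) refl N n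
    i≡ : i ≡ 2 * suc n ∸ 1
    i≡ = cong (_∸ 1) (sym (ℕₚ.*-suc 2 n))

mainTheorem16 : (N K : ℕ) → 1 ≤ K →
  ((m n : ℕ) → 1 ≤ n →
    ∃ λ c → (Fin c ↔ F N K m n) ×
      (+ c ≡ sumTo ((N * n + m) / suc (N + K)) (λ k →
          sgn k *ℤ + ((n C k) * ((n * (N + 2) + m ∸ k * suc (N + K)) C (2 * n))))))
  × ((n : ℕ) → 1 ≤ n →
    ∃ λ c → (Fin c ↔ P N K 1 n) ×
      (+ (n * c) ≡ sumTo ((N * n + 1) / suc (N + K)) (λ k →
          sgn k *ℤ + ((n C k) * ((n * (N + 2) ∸ k * suc (N + K)) C (2 * n ∸ 1))))))
mainTheorem16 N K _ = F-count N K , P-count N K
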